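{- The map $\varphi : X^\lambda_{d+1} \to \tilde{C}_d(\lambda^-;R)$, defined on generators by \[ \varphi(e_0 \wedge \cdots \wedge e_d \otimes v_1 \wedge \cdots \wedge v_t) = \mathrm{sgn}(\gamma)\cdot e_0 \otimes \cdots \otimes e_d, \] where $\gamma = e_0 \wedge \cdots \wedge e_d \otimes v_1 \wedge \cdots \wedge v_t$ with $e_j = x_jy_j$, $x_j<y_j$, and $\mathrm{sgn}(\gamma) = (-1)^{\mathrm{inv}(x_0,y_0,\ldots,x_d,y_d,v_1,\ldots,v_t)}$ (with $\mathrm{inv}(w)$ the number of pairs $i<j$ with $w_i>w_j$), is well defined and is an isomorphism of chain complexes between $\mathcal{X}^\lambda$ and $\mathcal{C}(\lambda^-;R)$.
   Context: Let $R$ be a commutative ring and $\lambda=(\lambda_1,\ldots,\lambda_r)$ a sequence of positive integers. $\mathcal{X}^\lambda=(X^\lambda_*,\delta)$ is the chain complex of the free two-step nilpotent Lie algebra: $X^\lambda_{d+1}$ is the free $R$-module generated by elements $e_0\wedge\cdots\wedge e_d\otimes v_1\wedge\cdots\wedge v_t$, where $v_1,\ldots,v_t\in\{1,\ldots,r\}$, $e_0,\ldots,e_d$ are edges (2-element subsets, no loops) on $\{1,\ldots,r\}$, and each $a$ occurs exactly $\lambda_a$ times in total among $(e_0,\ldots,e_d,v_1,\ldots,v_t)$; the element is zero if $e_i=e_j$ or $v_i=v_j$ for some $i\neq j$, and permuting the $e$'s by $\rho$ and the $v$'s by $\tau$ multiplies it by $\mathrm{sgn}(\rho)\mathrm{sgn}(\tau)$.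 The boundary is \[ \delta(x_0y_0\wedge\cdots\wedge x_dy_d\otimes v_1\wedge\cdots\wedge v_t)=\sum_{i=0}^d(-1)^i\, x_0y_0\wedge\cdots\wedge\widehat{x_iy_i}\wedge\cdots\wedge x_dy_d\otimes x_i\wedge y_i\wedge v_1\wedge\cdots\wedge v_t, \] with $x_j<y_j$. The complex $\mathcal{C}(\lambda^-;R)$ is the following complex (all elements of $\{1,\ldots,r\}$ "negatively charged"): order edges on $\{1,\ldots,r\}$ lexicographically; $\tilde{C}_d(\lambda^-;R)$ is free on generators $e_0\otimes\cdots\otimes e_d$ ($e_0\le\cdots\le e_d$) for multisets $\sigma=\{e_0,\ldots,e_d\}$ of edges on $\{1,\ldots,r\}$ containing no loop and no repeated edge, such that every $a$ has degree (number of occurrences in $\sigma$) equal to $\lambda_a-1$ or $\lambda_a$; any such symbol for a multiset violating these conditions is zero. Two edges commute if they share exactly one element and anticommute otherwise (in particular, disjoint edges anticommute); rearranging the factors of a generator multiplies it by $(-1)^\eta$, where $\eta$ is the number of anticommuting inversions. The boundary is $\partial(e_0\otimes\cdots\otimes e_d)=\sum_{i=0}^d(-1)^{d-\eta_i}\, e_0\otimes\cdots\otimes\widehat{e_i}\otimes\cdots\otimes e_d$, where $\eta_i$ is the number of $j>i$ such that $e_i$ and $e_j$ anticommute. (This is the complex whose homology is isomorphic to that of the subcomplex of the chain complex of the matching complex on $n=\sum\lambda_a$ vertices obtained from the natural signed action of the Young group $\mathfrak{S}_{\lambda_1}\times\cdots\times\mathfrak{S}_{\lambda_r}$.) -}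

module Defs where

open import Level using (Level; _⊔_)
open import Data.Nat as ℕ using (ℕ; zero; suc; _∸_; _<ᵇ_; _≡ᵇ_) renaming (_+_ to _+ℕ_)
open import Data.Fin as Fin using (Fin; toℕ)
open import Data.Bool using (Bool; true; false; if_then_else_; _∧_; _∨_; not)
open import Data.List as List using (List; []; _∷_; _++_)
open import Data.Vec as Vec using (Vec; []; _∷_)
open import Data.Maybe as Maybe using (Maybe; just; nothing)
open import Data.Product using (Σ; _×_; _,_; proj₁; proj₂)
open import Relation.Binary.PropositionalEquality
import Relation.Binary.PropositionalEquality as P
open import Data.Bool.ListAction using (and)
open import Algebra.Bundles using (CommutativeRing)

-- Combinatorial preliminaries (vertices are Fin r, i.e. {1,…,r}).

eqF : ∀ {r} → Fin r → Fin r → Bool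
eqF a b = toℕ a ≡ᵇ toℕ b

ltF : ∀ {r} → Fin r → Fin r → Bool
ltF a b = toℕ a <ᵇ toℕ b

record Edge (r : ℕ) : Set where
  constructor edge
  field
    x y : Fin r
    x<y : toℕ x ℕ.< toℕ y

open Edge public

eqE : ∀ {r} → Edge r → Edge r → Bool
eqE e f = eqF (x e) (x f) ∧ eqF (y e) (y f)

ltE : ∀ {r} → Edge r → Edge r → Bool
ltE e f = ltF (x e) (x f) ∨ (eqF (x e) (x f) ∧ ltF (y e) (y f))

b2n : Bool → ℕ
b2n true = 1
b2n false = 0

commute : ∀ {r} → Edge r → Edge r → Bool
commute e f = (b2n (eqF (x e) (x f)) +ℕ b2n (eqF (x e) (y f))
             +ℕ b2n (eqF (y e) (x f)) +ℕ b2n (eqF (y e) (y f))) ≡ᵇ 1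

anticommute : ∀ {r} → Edge r → Edge r → Bool
anticommute e f = not (commute e f)

cnt : ∀ {a} {A : Set a} → (A → Bool) → List A → ℕ
cnt p [] = 0
cnt p (a ∷ l) = if p a then suc (cnt p l) else cnt p l

pairsCount : ∀ {a} {A : Set a} → (A → A → Bool) → List A → ℕ
pairsCount rel [] = 0
pairsCount rel (a ∷ l) = cnt (rel a) l +ℕ pairsCount rel l

inv : ∀ {r} → List (Fin r) → ℕ
inv = pairsCount (λ a b → ltF b a)

invE : ∀ {r} → List (Edge r) → ℕ
invE = pairsCount (λ e f → ltE f e)

antiInv : ∀ {r} → List (Edge r) → ℕ
antiInv = pairsCount (λ e f → ltE f e ∧ anticommute e f)

flat : ∀ {r k} → Vec (Edge r) k → List (Fin r)
flat [] = []
flat (e ∷ es) = x e ∷ y e ∷ flat es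

occ : ∀ {r} → Fin r → List (Fin r) → ℕ
occ a = cnt (eqF a)

insertV : ∀ {a} {A : Set a} {n} → (A → A → Bool) → (A → A → Bool) →
          A → Vec A n → Maybe (Vec A (suc n))
insertV eq lt a [] = just (a ∷ [])
insertV eq lt a (b ∷ l) =
  if eq a b then nothing
  else (if lt a b then just (a ∷ b ∷ l)
        else Maybe.map (b ∷_) (insertV eq lt a l))

sortNubV : ∀ {a} {A : Set a} {n} → (A → A → Bool) → (A → A → Bool) →
           Vec A n → Maybe (Vec A n)
sortNubV eq lt [] = just []
sortNubV eq lt (a ∷ l) = Maybe._>>=_ (sortNubV eq lt l) (insertV eq lt a)

insertL : ∀ {a} {A : Set a} → (A → A → Bool) → (A → A → Bool) →
          A → List A → Maybe (List A)
insertL eq lt a [] = just (a ∷ [])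
insertL eq lt a (b ∷ l) =
  if eq a b then nothing
  else (if lt a b then just (a ∷ b ∷ l)
        else Maybe.map (b ∷_) (insertL eq lt a l))

sortNubL : ∀ {a} {A : Set a} → (A → A → Bool) → (A → A → Bool) →
           List A → Maybe (List A)
sortNubL eq lt [] = just []
sortNubL eq lt (a ∷ l) = Maybe._>>=_ (sortNubL eq lt l) (insertL eq lt a)

eqVecE : ∀ {r n} → Vec (Edge r) n → Vec (Edge r) n → Bool
eqVecE [] [] = true
eqVecE (e ∷ es) (f ∷ fs) = eqE e f ∧ eqVecE es fs

eqListF : ∀ {r} → List (Fin r) → List (Fin r) → Bool
eqListF [] [] = true
eqListF (a ∷ l) (b ∷ m) = eqF a b ∧ eqListF l m
eqListF _ _ = false

allFinB : ∀ {r} → (Fin r → Bool) → Bool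
allFinB {r} p = and (List.map p (List.allFin r))

-- Counting lemmas (needed so that δ stays inside the generators of X^λ)

cnt-cons-cong : ∀ {a} {A : Set a} (p : A → Bool) (u : A) (l m : List A) →
                cnt p l ≡ cnt p m → cnt p (u ∷ l) ≡ cnt p (u ∷ m)
cnt-cons-cong p u l m eq with p u
... | true = cong suc eq
... | false = eq

cnt-mid : ∀ {a} {A : Set a} (p : A → Bool) (l : List A) (u : A) (m : List A) →
          cnt p (l ++ u ∷ m) ≡ cnt p (u ∷ l ++ m)
cnt-mid p [] u m = refl
cnt-mid p (b ∷ l) u m with p b | p u | cnt-mid p l u m
... | true | true | ih = cong suc ih
... | true | false | ih = cong suc ih
... | false | true | ih = ih
... | false | false | ih = ih

cnt-mid2 : ∀ {a} {A : Set a} (p : A → Bool) (l : List A) (u w : A) (m : List A) →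
           cnt p (l ++ u ∷ w ∷ m) ≡ cnt p (u ∷ w ∷ l ++ m)
cnt-mid2 p l u w m =
  trans (cnt-mid p l u (w ∷ m)) (cnt-cons-cong p u (l ++ w ∷ m) (w ∷ l ++ m) (cnt-mid p l w m))

occ-remove : ∀ {r k} (a : Fin r) (es : Vec (Edge r) (suc k)) (i : Fin (suc k))
             (vs : List (Fin r)) →
             let e = Vec.lookup es i in
             occ a (flat (Vec.removeAt es i) ++ x e ∷ y e ∷ vs)
               ≡ occ a (flat es ++ vs)
occ-remove a (e ∷ es) Fin.zero vs = cnt-mid2 (eqF a) (flat es) (x e) (y e) vs
occ-remove a (e ∷ es@(_ ∷ _)) (Fin.suc i) vs =
  let f = Vec.lookup es i in
  cnt-cons-cong (eqF a) (x e) (y e ∷ flat (Vec.removeAt es i) ++ x f ∷ y f ∷ vs) (y e ∷ flat es ++ vs)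
    (cnt-cons-cong (eqF a) (y e) (flat (Vec.removeAt es i) ++ x f ∷ y f ∷ vs) (flat es ++ vs) (occ-remove a es i vs))

-- Elements of a free module are represented by finite formal R-linear
-- combinations of generator symbols (lists of (coefficient, symbol));
-- two combinations are equal in the module iff they have the same
-- coefficient at every basis element, where a symbol is rewritten in
-- terms of the basis using the defining relations (zero / sign rules).
-- Module addition is _++_ and scalar multiplication multiplies
-- coefficients; all maps below are the linear extensions of maps on
-- generators.

module Complexes {c ℓ} (R : CommutativeRing c ℓ) (r : ℕ) (lam : Fin r → ℕ) where

  open CommutativeRing R

  sgn : ℕ → Carrier
  sgn zero = 1#
  sgn (suc n) = - sgn n

  ΣR : List Carrier → Carrier
  ΣR = List.foldr _+_ 0#

  -- X^λ_k : generators e_0∧…∧e_{k-1} ⊗ v_1∧…∧v_t  (k = d+1 edges)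
  -- such that every a occurs exactly λ_a times in (e_0,…,e_{k-1},v_1,…,v_t).

  XGen : ℕ → Set
  XGen k = Σ (Vec (Edge r) k × List (Fin r))
             (λ s → ∀ a → occ a (flat (proj₁ s) ++ proj₂ s) ≡ lam a)

  XElem : ℕ → Set c
  XElem k = List (Carrier × XGen k)

  -- coefficient of a symbol at the basis element (b , bv)
  -- (b strictly increasing lexicographically, bv strictly increasing):
  -- zero if an edge or a vertex is repeated, otherwise
  -- sgn(ρ)sgn(τ) for the sorting permutations ρ, τ.
  coeffXgen : ∀ {k} → XGen k → Vec (Edge r) k × List (Fin r) → Carrier
  coeffXgen ((es , vs) , _) (b , bv)
    with sortNubV eqE ltE es | sortNubL eqF ltF vs
  ... | just es' | just vs' =
        if eqVecE es' b ∧ eqListF vs' bv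
        then sgn (invE (Vec.toList es) +ℕ inv vs) else 0#
  ... | _ | _ = 0#

  coeffX : ∀ {k} → XElem k → Vec (Edge r) k × List (Fin r) → Carrier
  coeffX z b = ΣR (List.map (λ { (a , g) → coeffXgen g b * a }) z)

  _≈X_ : ∀ {k} → XElem k → XElem k → Set ℓ
  _≈X_ {k} z w = ∀ (b : Vec (Edge r) k × List (Fin r)) → coeffX z b ≈ coeffX w b

  δgen : ∀ {k} → XGen (suc k) → List (Carrier × XGen k)
  δgen {k} ((es , vs) , p) =
    List.map (λ i → sgn (toℕ i) ,
                    ((Vec.removeAt es i , x (Vec.lookup es i) ∷ y (Vec.lookup es i) ∷ vs) ,
                     λ a → P.trans (occ-remove a es i vs) (p a)))
             (List.allFin (suc k))

  δ : ∀ {k} → XElem (suc k) → XElem k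
  δ z = List.concatMap (λ { (a , g) →
          List.map (λ { (s , h) → (s * a , h) }) (δgen g) }) z

  -- \tilde C(λ^-; R) with k edges, i.e. \tilde C_{k-1}.

  CElem : ℕ → Set c
  CElem k = List (Carrier × Vec (Edge r) k)

  degOK : ∀ {k} → Vec (Edge r) k → Bool
  degOK es = allFinB (λ a → (occ a (flat es) ≡ᵇ (lam a ∸ 1)) ∨ (occ a (flat es) ≡ᵇ lam a))

  -- a symbol e_0⊗…⊗e_{k-1} written in the basis: zero if it has a repeated
  -- edge or violates the degree condition, otherwise (-1)^η times the sorted
  -- generator, η = number of anticommuting inversions.
  normC : ∀ {k} → Vec (Edge r) k → Maybe (Carrier × Vec (Edge r) k)
  normC es with degOK es | sortNubV eqE ltE es
  ... | true | just es' = just (sgn (antiInv (Vec.toList es)) , es')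
  ... | _ | _ = nothing

  coeffCgen : ∀ {k} → Vec (Edge r) k → Vec (Edge r) k → Carrier
  coeffCgen es b with normC es
  ... | just (s , es') = if eqVecE es' b then s else 0#
  ... | nothing = 0#

  coeffC : ∀ {k} → CElem k → Vec (Edge r) k → Carrier
  coeffC z b = ΣR (List.map (λ { (a , es) → coeffCgen es b * a }) z)

  _≈C_ : ∀ {k} → CElem k → CElem k → Set ℓ
  _≈C_ {k} z w = ∀ (b : Vec (Edge r) k) → coeffC z b ≈ coeffC w b

  -- ∂ on a basis element e_0⊗…⊗e_d (sorted):
  -- Σ_i (-1)^{d - η_i} e_0⊗…\hat{e_i}…⊗e_d, η_i = #{j > i : e_i, e_j anticommute}
  ∂basis : ∀ {k} → Vec (Edge r) (suc k) → List (Carrier × Vec (Edge r) k)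
  ∂basis {k} es =
    List.map (λ i → sgn (k ∸ cnt (anticommute (Vec.lookup es i))
                                  (List.drop (suc (toℕ i)) (Vec.toList es))) ,
                    Vec.removeAt es i)
             (List.allFin (suc k))

  -- ∂ extended linearly (a symbol is first written in the basis)
  ∂ : ∀ {k} → CElem (suc k) → CElem k
  ∂ z = List.concatMap (λ { (a , es) → ∂sym a es }) z
    where
    ∂sym : ∀ {k} → Carrier → Vec (Edge r) (suc k) → CElem k
    ∂sym a es with normC es
    ... | just (s , es') = List.map (λ { (t , h) → (t * (s * a) , h) }) (∂basis es')
    ... | nothing = []

  φ : ∀ {k} → XElem k → CElem k
  φ z = List.map (λ { (a , ((es , vs) , _)) → (sgn (inv (flat es ++ vs)) * a , es) }) z

-- A generator es ⊗ v of X^λ vanishes unless v, sorted, is the list missing(es) of the vertices a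
-- with deg_es(a) = λ_a − 1. Hence the coefficient of φ(z) at a basis element b of C is σ(b) times
-- the coefficient of z at b ⊗ missing(b), for a fixed sign σ(b); this gives well-definedness,
-- injectivity and, as λ_a ≥ 1, surjectivity. All coefficients involved are alternating in the
-- edges, so it suffices to compare them on sorted edge lists: swapping two adjacent distinct edges
-- changes inv(x₀y₀…x_dy_d v) by the number of vertices they share mod 2, i.e. by 1 exactly when
-- they commute, while the sign in C changes exactly when they anticommute. The chain-map identity
-- is proved the same way: on a sorted edge list the sign (-1)^i of the i-th term of δ turns into
-- the sign (-1)^(d-ηᵢ) of the i-th term of ∂ once the inversions created by moving xᵢyᵢ to the
-- vertices are counted.

module Submission where

open import Algebra.Bundles using (CommutativeRing)
open import Data.Fin using (Fin)
open import Data.Nat using (ℕ; suc; _≤_)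
open import Data.Product using (Σ; _×_; _,_)
open import Level using (Level)

open import Defs

module Orders where

  open import Data.Bool using (Bool; true; false; not; _∧_; _∨_; if_then_else_)
  open import Data.Bool.Properties using (T-≡)
  open import Data.Empty using (⊥-elim)
  open import Data.Fin as Fin using (Fin; toℕ)
  open import Data.Fin.Properties using (toℕ-injective)
  open import Data.List as List using (List; []; _∷_; _++_; length)
  open import Data.List.Relation.Binary.Permutation.Propositional
    using (_↭_; prep; swap; ↭-refl; ↭-sym; ↭-trans)
  open import Data.List.Membership.Propositional using (_∈_)
  open import Data.List.Relation.Unary.All as All using (All; []; _∷_)
  open import Data.List.Relation.Unary.Any using (here; there)
  open import Data.List.Relation.Unary.AllPairs as AllPairs using (AllPairs; []; _∷_)
  open import Data.List.Relation.Unary.Linked as Linked using (Linked; []; [-]; _∷_)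
  open import Data.List.Relation.Unary.Linked.Properties as Linked using (Linked⇒AllPairs)
  open import Data.List.Membership.Propositional.Properties using (∈-allFin)
  import Data.List.Properties as List
  open import Data.Maybe as Maybe using (Maybe; just; nothing)
  open import Data.Maybe.Properties using (map-injective)
  open import Data.Nat using (ℕ; zero; suc; _+_; _<ᵇ_; _≡ᵇ_; _≤_; _<_; z≤n; s≤s)
  open import Data.Nat.Properties as ℕ
    using (<⇒<ᵇ; <ᵇ⇒<; ≡ᵇ⇒≡; <-cmp; <-trans; <⇒≤; <⇒≱; ≤-refl; <-irrelevant)
  open import Data.Product using (Σ; ∃; _×_; _,_)
  open import Data.Nat.Tactic.RingSolver using (solve-∀)
  open import Data.Sum using (_⊎_; inj₁; inj₂)
  open import Data.Vec as Vec using (Vec; []; _∷_)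
  open import Data.Vec.Properties using (toList-injective)
  open import Data.Vec.Relation.Binary.Equality.Cast using (cast-is-id)
  open import Function using (Equivalence; _∘_)
  open import Relation.Binary.Definitions using (tri<; tri≈; tri>)
  open import Relation.Binary.PropositionalEquality


  true≢false : true ≢ false
  true≢false ()

  cnt-cons : ∀ {a} {A : Set a} (p : A → Bool) u l → cnt p (u ∷ l) ≡ b2n (p u) + cnt p l
  cnt-cons p u l with p u
  ... | true = refl
  ... | false = refl

  cnt-++ : ∀ {a} {A : Set a} (p : A → Bool) l m → cnt p (l ++ m) ≡ cnt p l + cnt p m
  cnt-++ p [] m = refl
  cnt-++ p (u ∷ l) m with p u
  ... | true = cong suc (cnt-++ p l m)
  ... | false = cnt-++ p l m

  cnt-↭ : ∀ {a} {A : Set a} (p : A → Bool) {l m : List A} → l ↭ m → cnt p l ≡ cnt p m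
  cnt-↭ p _↭_.refl = refl
  cnt-↭ p (prep {xs = l} {ys = m} u l↭m) = cnt-cons-cong p u l m (cnt-↭ p l↭m)
  cnt-↭ p (swap u w l↭m) with p u | p w
  ... | true | true = cong (λ n → suc (suc n)) (cnt-↭ p l↭m)
  ... | true | false = cong suc (cnt-↭ p l↭m)
  ... | false | true = cong suc (cnt-↭ p l↭m)
  ... | false | false = cnt-↭ p l↭m
  cnt-↭ p (_↭_.trans l↭m m↭n) = trans (cnt-↭ p l↭m) (cnt-↭ p m↭n)

  cnt-≤-cons : ∀ {a} {A : Set a} (p : A → Bool) u l → cnt p l ≤ cnt p (u ∷ l)
  cnt-≤-cons p u l rewrite cnt-cons p u l = ℕ.m≤n+m (cnt p l) (b2n (p u))

  cnt-≤-length : ∀ {a} {A : Set a} (p : A → Bool) l → cnt p l ≤ length l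
  cnt-≤-length p [] = z≤n
  cnt-≤-length p (u ∷ l) with p u
  ... | true = s≤s (cnt-≤-length p l)
  ... | false = ℕ.m≤n⇒m≤1+n (cnt-≤-length p l)

  cnt-complement : ∀ {a} {A : Set a} (p : A → Bool) l → cnt p l + cnt (λ u → not (p u)) l ≡ length l
  cnt-complement p [] = refl
  cnt-complement p (u ∷ l) with p u
  ... | true = cong suc (cnt-complement p l)
  ... | false = trans (ℕ.+-suc (cnt p l) _) (cong suc (cnt-complement p l))

  cnt≡0 : ∀ {a} {A : Set a} {p : A → Bool} {l} → All (λ u → p u ≡ false) l → cnt p l ≡ 0
  cnt≡0 [] = refl
  cnt≡0 (pu≡false ∷ rest) rewrite pu≡false = cnt≡0 rest

  pairsCount≡0 : ∀ {a} {A : Set a} {rel : A → A → Bool} {l} →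
                 AllPairs (λ u w → rel u w ≡ false) l → pairsCount rel l ≡ 0
  pairsCount≡0 [] = refl
  pairsCount≡0 (none ∷ rest) rewrite cnt≡0 none = pairsCount≡0 rest

  <ᵇ-true : ∀ {m n} → m < n → (m <ᵇ n) ≡ true
  <ᵇ-true m<n = Equivalence.to T-≡ (<⇒<ᵇ m<n)

  <ᵇ-false : ∀ {m n} → n ≤ m → (m <ᵇ n) ≡ false
  <ᵇ-false {m} {n} n≤m with m <ᵇ n in e
  ... | false = refl
  ... | true = ⊥-elim (<⇒≱ (<ᵇ⇒< m n (Equivalence.from T-≡ e)) n≤m)

  <ᵇ-sound : ∀ {m n} → (m <ᵇ n) ≡ true → m < n
  <ᵇ-sound {m} {n} e = <ᵇ⇒< m n (Equivalence.from T-≡ e)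

  ≡ᵇ-refl : ∀ m → (m ≡ᵇ m) ≡ true
  ≡ᵇ-refl zero = refl
  ≡ᵇ-refl (suc m) = ≡ᵇ-refl m

  ≡ᵇ-sound : ∀ {m n} → (m ≡ᵇ n) ≡ true → m ≡ n
  ≡ᵇ-sound {m} {n} e = ≡ᵇ⇒≡ m n (Equivalence.from T-≡ e)

  ≡ᵇ-false : ∀ {m n} → m ≢ n → (m ≡ᵇ n) ≡ false
  ≡ᵇ-false {m} {n} m≢n with m ≡ᵇ n in e
  ... | false = refl
  ... | true = ⊥-elim (m≢n (≡ᵇ-sound e))

  ≡ᵇ-sym : ∀ m n → (m ≡ᵇ n) ≡ (n ≡ᵇ m)
  ≡ᵇ-sym zero zero = refl
  ≡ᵇ-sym zero (suc n) = refl
  ≡ᵇ-sym (suc m) zero = refl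
  ≡ᵇ-sym (suc m) (suc n) = ≡ᵇ-sym m n

  data Trichotomy {A : Set} (eq lt : A → A → Bool) (a b : A) : Set where
    less    : lt a b ≡ true → lt b a ≡ false → eq a b ≡ false → eq b a ≡ false → Trichotomy eq lt a b
    equal   : a ≡ b → Trichotomy eq lt a b
    greater : lt a b ≡ false → lt b a ≡ true → eq a b ≡ false → eq b a ≡ false → Trichotomy eq lt a b

  record IsStrictTotalOrderᵇ {A : Set} (eq lt : A → A → Bool) : Set where
    field
      compare   : ∀ a b → Trichotomy eq lt a b
      lt-trans  : ∀ {a b c} → lt a b ≡ true → lt b c ≡ true → lt a c ≡ true
      eq-refl   : ∀ a → eq a a ≡ true
      lt-irrefl : ∀ a → lt a a ≡ false

  ℕ-compare : ∀ m n → Trichotomy _≡ᵇ_ _<ᵇ_ m n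
  ℕ-compare m n with <-cmp m n
  ... | tri< m<n m≢n _ = less (<ᵇ-true m<n) (<ᵇ-false (<⇒≤ m<n)) (≡ᵇ-false m≢n) (≡ᵇ-false (m≢n ∘ sym))
  ... | tri≈ _ refl _ = equal refl
  ... | tri> _ m≢n n<m = greater (<ᵇ-false (<⇒≤ n<m)) (<ᵇ-true n<m) (≡ᵇ-false m≢n) (≡ᵇ-false (m≢n ∘ sym))

  Fin-compare : ∀ {r} (a b : Fin r) → Trichotomy eqF ltF a b
  Fin-compare a b with ℕ-compare (toℕ a) (toℕ b)
  ... | less p q s t = less p q s t
  ... | equal e = equal (toℕ-injective e)
  ... | greater p q s t = greater p q s t

  Fin-isStrictTotalOrderᵇ : ∀ {r} → IsStrictTotalOrderᵇ (eqF {r}) ltF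
  Fin-isStrictTotalOrderᵇ = record
    { compare   = Fin-compare
    ; lt-trans  = λ {a} {b} {c} p q → <ᵇ-true (<-trans (<ᵇ-sound {toℕ a} p) (<ᵇ-sound {toℕ b} {toℕ c} q))
    ; eq-refl   = λ a → ≡ᵇ-refl (toℕ a)
    ; lt-irrefl = λ a → <ᵇ-false (≤-refl {toℕ a})
    }

  eqF-sound : ∀ {r} {a b : Fin r} → eqF a b ≡ true → a ≡ b
  eqF-sound e = toℕ-injective (≡ᵇ-sound e)

  edge-≡ : ∀ {r} {e f : Edge r} → x e ≡ x f → y e ≡ y f → e ≡ f
  edge-≡ {e = edge u v p} {edge .u .v q} refl refl = cong (edge u v) (<-irrelevant p q)

  ltE-sameˣ : ∀ {r} (e f : Edge r) → x e ≡ x f → ltE e f ≡ ltF (y e) (y f)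
  ltE-sameˣ e f refl rewrite <ᵇ-false (≤-refl {toℕ (x e)}) | ≡ᵇ-refl (toℕ (x e)) = refl

  eqE-sameˣ : ∀ {r} (e f : Edge r) → x e ≡ x f → eqE e f ≡ eqF (y e) (y f)
  eqE-sameˣ e f refl rewrite ≡ᵇ-refl (toℕ (x e)) = refl

  Edge-compare : ∀ {r} (e f : Edge r) → Trichotomy eqE ltE e f
  Edge-compare e f with Fin-compare (x e) (x f)
  ... | less p q s t =
        less (cong (_∨ (eqF (x e) (x f) ∧ ltF (y e) (y f))) p) (cong₂ (λ u v → u ∨ (v ∧ ltF (y f) (y e))) q t)
             (cong (_∧ eqF (y e) (y f)) s) (cong (_∧ eqF (y f) (y e)) t)
  ... | greater p q s t =
        greater (cong₂ (λ u v → u ∨ (v ∧ ltF (y e) (y f))) p s) (cong (_∨ (eqF (x f) (x e) ∧ ltF (y f) (y e))) q)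
                (cong (_∧ eqF (y e) (y f)) s) (cong (_∧ eqF (y f) (y e)) t)
  ... | equal xe≡xf with Fin-compare (y e) (y f)
  ...   | less p q s t =
          less (trans (ltE-sameˣ e f xe≡xf) p) (trans (ltE-sameˣ f e (sym xe≡xf)) q)
               (trans (eqE-sameˣ e f xe≡xf) s) (trans (eqE-sameˣ f e (sym xe≡xf)) t)
  ...   | greater p q s t =
          greater (trans (ltE-sameˣ e f xe≡xf) p) (trans (ltE-sameˣ f e (sym xe≡xf)) q)
                  (trans (eqE-sameˣ e f xe≡xf) s) (trans (eqE-sameˣ f e (sym xe≡xf)) t)
  ...   | equal ye≡yf = equal (edge-≡ xe≡xf ye≡yf)

  ltE-lex : ∀ {r} (e f : Edge r) → ltE e f ≡ true →
            toℕ (x e) < toℕ (x f) ⊎ (x e ≡ x f × toℕ (y e) < toℕ (y f))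
  ltE-lex e f h with ltF (x e) (x f) in p | eqF (x e) (x f) in q | ltF (y e) (y f) in s
  ... | true  | _     | _     = inj₁ (<ᵇ-sound p)
  ... | false | true  | true  = inj₂ (eqF-sound q , <ᵇ-sound s)
  ... | false | true  | false = ⊥-elim (true≢false (sym h))
  ... | false | false | _     = ⊥-elim (true≢false (sym h))

  ltE-byˣ : ∀ {r} (e f : Edge r) → toℕ (x e) < toℕ (x f) → ltE e f ≡ true
  ltE-byˣ e f xe<xf rewrite <ᵇ-true xe<xf = refl

  ltE-trans : ∀ {r} {e f g : Edge r} → ltE e f ≡ true → ltE f g ≡ true → ltE e g ≡ true
  ltE-trans {e = e} {f} {g} p q with ltE-lex e f p | ltE-lex f g q
  ... | inj₁ u | inj₁ v = ltE-byˣ e g (<-trans u v)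
  ... | inj₁ u | inj₂ (refl , _) = ltE-byˣ e g u
  ... | inj₂ (refl , _) | inj₁ v = ltE-byˣ e g v
  ... | inj₂ (refl , u) | inj₂ (refl , v) = trans (ltE-sameˣ e g refl) (<ᵇ-true (<-trans u v))

  Edge-isStrictTotalOrderᵇ : ∀ {r} → IsStrictTotalOrderᵇ (eqE {r}) ltE
  Edge-isStrictTotalOrderᵇ = record
    { compare   = Edge-compare
    ; lt-trans  = λ {e} {f} {g} → ltE-trans {e = e} {f} {g}
    ; eq-refl   = λ e → cong₂ _∧_ (≡ᵇ-refl (toℕ (x e))) (≡ᵇ-refl (toℕ (y e)))
    ; lt-irrefl = λ e → trans (ltE-sameˣ e e refl) (<ᵇ-false (≤-refl {toℕ (y e)}))
    }

  swapAt : ∀ {A : Set} {n} → ℕ → Vec A n → Vec A n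
  swapAt zero (a ∷ b ∷ l) = b ∷ a ∷ l
  swapAt (suc j) (a ∷ l) = a ∷ swapAt j l
  swapAt _ l = l

  adjacentAt : ∀ {A : Set} {n} → ℕ → Vec A n → Maybe (A × A)
  adjacentAt zero (a ∷ b ∷ l) = just (a , b)
  adjacentAt (suc j) (a ∷ l) = adjacentAt j l
  adjacentAt _ _ = nothing

  swapAt-↭ : ∀ {A : Set} {n} j (l : Vec A n) → Vec.toList (swapAt j l) ↭ Vec.toList l
  swapAt-↭ zero [] = ↭-refl
  swapAt-↭ zero (a ∷ []) = ↭-refl
  swapAt-↭ zero (a ∷ b ∷ l) = swap b a ↭-refl
  swapAt-↭ (suc j) [] = ↭-refl
  swapAt-↭ (suc j) (a ∷ l) = prep a (swapAt-↭ j l)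

  adjacentAt-swapAt : ∀ {A : Set} {n} j (l : Vec A n) {a b : A} →
                      adjacentAt j l ≡ just (a , b) → adjacentAt j (swapAt j l) ≡ just (b , a)
  adjacentAt-swapAt zero (a ∷ b ∷ l) refl = refl
  adjacentAt-swapAt (suc j) (a ∷ l) e = adjacentAt-swapAt j l e

  swapAt-involutive : ∀ {A : Set} {n} j (l : Vec A n) {a b : A} →
                      adjacentAt j l ≡ just (a , b) → swapAt j (swapAt j l) ≡ l
  swapAt-involutive zero (a ∷ b ∷ l) refl = refl
  swapAt-involutive (suc j) (a ∷ l) e = cong (a ∷_) (swapAt-involutive j l e)

  -- Sorting without repetitions

  module StrictOrderᵇ {A : Set} {eq lt : A → A → Bool} (O : IsStrictTotalOrderᵇ eq lt) where
    open IsStrictTotalOrderᵇ O public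

    eq-sound : ∀ {a b} → eq a b ≡ true → a ≡ b
    eq-sound {a} {b} h with compare a b
    ... | less _ _ s _ = ⊥-elim (true≢false (trans (sym h) s))
    ... | equal e = e
    ... | greater _ _ s _ = ⊥-elim (true≢false (trans (sym h) s))

    lt-asym : ∀ {a b} → lt a b ≡ true → lt b a ≡ false
    lt-asym {a} {b} h with compare a b
    ... | less _ q _ _ = q
    ... | equal refl = ⊥-elim (true≢false (trans (sym h) (lt-irrefl a)))
    ... | greater p _ _ _ = ⊥-elim (true≢false (trans (sym h) p))

    lt⇒¬eq : ∀ {a b} → lt a b ≡ true → eq a b ≡ false
    lt⇒¬eq {a} {b} h with compare a b
    ... | less _ _ s _ = s
    ... | equal refl = ⊥-elim (true≢false (trans (sym h) (lt-irrefl a)))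
    ... | greater p _ _ _ = ⊥-elim (true≢false (trans (sym h) p))

    Sorted : List A → Set
    Sorted = Linked (λ a b → lt a b ≡ true)

    sorted⇒allPairs : ∀ {l} → Sorted l → AllPairs (λ a b → lt a b ≡ true) l
    sorted⇒allPairs = Linked⇒AllPairs lt-trans

    pairsCount-sorted : (rel : A → A → Bool) → (∀ {a b} → lt a b ≡ true → rel a b ≡ false) →
                        ∀ {l} → Sorted l → pairsCount rel l ≡ 0
    pairsCount-sorted rel vanish s = pairsCount≡0 (AllPairs.map vanish (sorted⇒allPairs s))

    invL : List A → ℕ
    invL = pairsCount (λ a b → lt b a)

    sorted-cnt≤1 : ∀ a {l} → Sorted l → cnt (eq a) l ≤ 1
    sorted-cnt≤1 a s = go (sorted⇒allPairs s)
      where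
      go : ∀ {l} → AllPairs (λ a b → lt a b ≡ true) l → cnt (eq a) l ≤ 1
      go [] = z≤n
      go (_∷_ {x = b} {xs = l} above rest) with eq a b in e
      ... | true rewrite eq-sound e | cnt≡0 (All.map lt⇒¬eq above) = s≤s z≤n
      ... | false = go rest

    ∈⇒1≤cnt : ∀ {a l} → a ∈ l → 1 ≤ cnt (eq a) l
    ∈⇒1≤cnt {a} (here refl) rewrite eq-refl a = s≤s z≤n
    ∈⇒1≤cnt {a} (there {x = b} {xs = l} a∈l) = ℕ.≤-trans (∈⇒1≤cnt a∈l) (cnt-≤-cons (eq a) b l)

    cnt-filterᵇ : ∀ (p : A → Bool) a l → cnt (eq a) (List.filterᵇ p l) ≡ (if p a then cnt (eq a) l else 0)
    cnt-filterᵇ p a [] with p a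
    ... | true = refl
    ... | false = refl
    cnt-filterᵇ p a (b ∷ l) with eq a b in a≡b | p b in pb | p a in pa | cnt-filterᵇ p a l
    ... | true  | true  | true  | ih rewrite a≡b = cong suc ih
    ... | true  | true  | false | ih = ⊥-elim (true≢false (trans (sym pb) (trans (cong p (sym (eq-sound a≡b))) pa)))
    ... | true  | false | true  | ih = ⊥-elim (true≢false (trans (sym pa) (trans (cong p (eq-sound a≡b)) pb)))
    ... | true  | false | false | ih = ih
    ... | false | true  | _     | ih rewrite a≡b = ih
    ... | false | false | _     | ih = ih

    cnt-eq-self : ∀ a (l : List A) → cnt (eq a) (a ∷ l) ≡ suc (cnt (eq a) l)
    cnt-eq-self a l rewrite eq-refl a = refl

    sorted-cnt-head : ∀ {a c l} → lt a c ≡ true → Sorted (c ∷ l) → cnt (eq a) (c ∷ l) ≡ 0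
    sorted-cnt-head a<c s with sorted⇒allPairs s
    ... | above ∷ _ = cnt≡0 (All.map lt⇒¬eq (a<c ∷ All.map (lt-trans a<c) above))

    sorted-unique : ∀ {u w} → Sorted u → Sorted w → (∀ a → cnt (eq a) u ≡ cnt (eq a) w) → u ≡ w
    sorted-unique {[]} {[]} _ _ _ = refl
    sorted-unique {[]} {c ∷ w} _ _ h = ⊥-elim (ℕ.0≢1+n (trans (h c) (cnt-eq-self c w)))
    sorted-unique {a ∷ u} {[]} _ _ h = ⊥-elim (ℕ.0≢1+n (trans (sym (h a)) (cnt-eq-self a u)))
    sorted-unique {a ∷ u} {c ∷ w} su sw h with compare a c
    ... | equal refl = cong (a ∷_) (sorted-unique (Linked.tail su) (Linked.tail sw) (λ b →
            ℕ.+-cancelˡ-≡ (b2n (eq b a)) _ _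
              (trans (sym (cnt-cons (eq b) a u)) (trans (h b) (cnt-cons (eq b) a w)))))
    ... | less a<c _ _ _ = ⊥-elim (ℕ.0≢1+n (trans (sym (sorted-cnt-head a<c sw))
                                   (trans (sym (h a)) (cnt-eq-self a u))))
    ... | greater _ c<a _ _ = ⊥-elim (ℕ.0≢1+n (trans (sym (sorted-cnt-head c<a su))
                                   (trans (h c) (cnt-eq-self c w))))

    lt-total : ∀ {a b} → lt a b ≡ false → eq a b ≡ false → lt b a ≡ true
    lt-total {a} {b} a≮b a≢b with compare a b
    ... | less a<b _ _ _ = ⊥-elim (true≢false (trans (sym a<b) a≮b))
    ... | equal refl = ⊥-elim (true≢false (trans (sym (eq-refl a)) a≢b))
    ... | greater _ b<a _ _ = b<a

    insertL-↭ : ∀ a m {m'} → insertL eq lt a m ≡ just m' → m' ↭ a ∷ m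
    insertL-↭ a [] refl = ↭-refl
    insertL-↭ a (c ∷ m) h with eq a c | lt a c
    insertL-↭ a (c ∷ m) () | true | _
    insertL-↭ a (c ∷ m) refl | false | true = ↭-refl
    ... | false | false with insertL eq lt a m in e
    insertL-↭ a (c ∷ m) () | false | false | nothing
    insertL-↭ a (c ∷ m) refl | false | false | just _ = ↭-trans (prep c (insertL-↭ a m e)) (swap c a ↭-refl)

    insertL-sorted-above : ∀ a c m {m'} → lt c a ≡ true → Sorted (c ∷ m) → insertL eq lt a m ≡ just m' →
                           Sorted (c ∷ m')
    insertL-sorted-above a c [] c<a _ refl = c<a ∷ [-]
    insertL-sorted-above a c (d ∷ m) c<a (c<d ∷ s) h with eq a d in a≢d | lt a d in a<d
    insertL-sorted-above a c (d ∷ m) c<a (c<d ∷ s) () | true | _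
    insertL-sorted-above a c (d ∷ m) c<a (c<d ∷ s) refl | false | true = c<a ∷ a<d ∷ s
    ... | false | false with insertL eq lt a m in e
    insertL-sorted-above a c (d ∷ m) c<a (c<d ∷ s) () | false | false | nothing
    insertL-sorted-above a c (d ∷ m) c<a (c<d ∷ s) refl | false | false | just _ =
      c<d ∷ insertL-sorted-above a d m (lt-total a<d a≢d) s e

    insertL-sorted : ∀ a m {m'} → Sorted m → insertL eq lt a m ≡ just m' → Sorted m'
    insertL-sorted a [] _ refl = [-]
    insertL-sorted a (c ∷ m) s h with eq a c in a≢c | lt a c in a<c
    insertL-sorted a (c ∷ m) s () | true | _
    insertL-sorted a (c ∷ m) s refl | false | true = a<c ∷ s
    ... | false | false with insertL eq lt a m in e
    insertL-sorted a (c ∷ m) s () | false | false | nothing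
    insertL-sorted a (c ∷ m) s refl | false | false | just _ = insertL-sorted-above a c m (lt-total a<c a≢c) s e

    insertL-nothing : ∀ a m → insertL eq lt a m ≡ nothing → 1 ≤ cnt (eq a) m
    insertL-nothing a [] ()
    insertL-nothing a (c ∷ m) h with eq a c | lt a c
    ... | true | _ = s≤s z≤n
    insertL-nothing a (c ∷ m) () | false | true
    ... | false | false with insertL eq lt a m in e
    ...   | nothing = insertL-nothing a m e
    insertL-nothing a (c ∷ m) () | false | false | just _

    insertL-below : ∀ {a c} m → lt a c ≡ true → insertL eq lt a (c ∷ m) ≡ just (a ∷ c ∷ m)
    insertL-below m a<c rewrite lt⇒¬eq a<c | a<c = refl

    sortNubL-sound : ∀ l {l'} → sortNubL eq lt l ≡ just l' → l' ↭ l × Sorted l'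
    sortNubL-sound [] refl = ↭-refl , []
    sortNubL-sound (a ∷ l) h with sortNubL eq lt l in e
    sortNubL-sound (a ∷ l) () | nothing
    ... | just m with sortNubL-sound l e
    ...   | m↭l , sm = ↭-trans (insertL-↭ a m h) (prep a m↭l) , insertL-sorted a m sm h

    sortNubL-cnt≤1 : ∀ l {l'} → sortNubL eq lt l ≡ just l' → ∀ a → cnt (eq a) l ≤ 1
    sortNubL-cnt≤1 l h a with sortNubL-sound l h
    ... | l'↭l , sl' = subst (_≤ 1) (cnt-↭ (eq a) l'↭l) (sorted-cnt≤1 a sl')

    sortNubL-nothing : ∀ l → sortNubL eq lt l ≡ nothing → ∃ λ b → 2 ≤ cnt (eq b) l
    sortNubL-nothing [] ()
    sortNubL-nothing (a ∷ l) h with sortNubL eq lt l in e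
    ... | nothing with sortNubL-nothing l e
    ...   | b , 2≤ = b , ℕ.≤-trans 2≤ (cnt-≤-cons (eq b) a l)
    sortNubL-nothing (a ∷ l) h | just m with sortNubL-sound l e
    ...   | m↭l , _ = a , subst (2 ≤_) (sym (cnt-eq-self a l))
                            (s≤s (subst (1 ≤_) (cnt-↭ (eq a) m↭l) (insertL-nothing a m h)))

    sortNubL-dup : ∀ l {b} → 2 ≤ cnt (eq b) l → sortNubL eq lt l ≡ nothing
    sortNubL-dup l {b} 2≤ with sortNubL eq lt l in e
    ... | nothing = refl
    ... | just _ = ⊥-elim (ℕ.≤⇒≯ (sortNubL-cnt≤1 l e b) 2≤)

    sortNubL-↭ : ∀ {l m} → l ↭ m → sortNubL eq lt l ≡ sortNubL eq lt m
    sortNubL-↭ {l} {m} l↭m with sortNubL eq lt l in el | sortNubL eq lt m in em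
    ... | nothing | nothing = refl
    ... | just u | just w with sortNubL-sound l el | sortNubL-sound m em
    ...   | u↭l , su | w↭m , sw =
            cong just (sorted-unique su sw (λ a → cnt-↭ (eq a) (↭-trans u↭l (↭-trans l↭m (↭-sym w↭m)))))
    sortNubL-↭ {l} {m} l↭m | just u | nothing with sortNubL-nothing m em
    ... | b , 2≤ = ⊥-elim (ℕ.≤⇒≯ (sortNubL-cnt≤1 l el b) (subst (2 ≤_) (sym (cnt-↭ (eq b) l↭m)) 2≤))
    sortNubL-↭ {l} {m} l↭m | nothing | just w with sortNubL-nothing l el
    ... | b , 2≤ = ⊥-elim (ℕ.≤⇒≯ (sortNubL-cnt≤1 m em b) (subst (2 ≤_) (cnt-↭ (eq b) l↭m) 2≤))

    sortNubL-sorted : ∀ {l} → Sorted l → sortNubL eq lt l ≡ just l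
    sortNubL-sorted [] = refl
    sortNubL-sorted [-] = refl
    sortNubL-sorted {a ∷ b ∷ l} (a<b ∷ s) rewrite sortNubL-sorted s = insertL-below l a<b

    toList-insertV : ∀ {n} a (v : Vec A n) →
                     Maybe.map Vec.toList (insertV eq lt a v) ≡ insertL eq lt a (Vec.toList v)
    toList-insertV a [] = refl
    toList-insertV a (b ∷ v) with eq a b | lt a b
    ... | true | _ = refl
    ... | false | true = refl
    ... | false | false with insertV eq lt a v | toList-insertV a v
    ...   | nothing | ih = cong (Maybe.map (b ∷_)) ih
    ...   | just _ | ih = cong (Maybe.map (b ∷_)) ih

    toList-sortNubV : ∀ {n} (v : Vec A n) → Maybe.map Vec.toList (sortNubV eq lt v) ≡ sortNubL eq lt (Vec.toList v)
    toList-sortNubV [] = refl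
    toList-sortNubV (a ∷ v) with sortNubV eq lt v | toList-sortNubV v
    ... | nothing | ih rewrite sym ih = refl
    ... | just w | ih rewrite sym ih = toList-insertV a w

    toList-injective′ : ∀ {n} {u v : Vec A n} → Vec.toList u ≡ Vec.toList v → u ≡ v
    toList-injective′ {u = u} {v} e = trans (sym (cast-is-id refl u)) (toList-injective refl u v e)

    sortNubV-↭ : ∀ {n} {u v : Vec A n} → Vec.toList u ↭ Vec.toList v → sortNubV eq lt u ≡ sortNubV eq lt v
    sortNubV-↭ {u = u} {v} u↭v = map-injective toList-injective′
      (trans (toList-sortNubV u) (trans (sortNubL-↭ u↭v) (sym (toList-sortNubV v))))

    sortNubV-sorted : ∀ {n} {v : Vec A n} → Sorted (Vec.toList v) → sortNubV eq lt v ≡ just v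
    sortNubV-sorted {v = v} s = map-injective toList-injective′ (trans (toList-sortNubV v) (sortNubL-sorted s))

    sortNubV-dup : ∀ {n} (v : Vec A n) {b} → 2 ≤ cnt (eq b) (Vec.toList v) → sortNubV eq lt v ≡ nothing
    sortNubV-dup v 2≤ with sortNubV eq lt v | toList-sortNubV v
    ... | nothing | _ = refl
    ... | just _ | e = ⊥-elim (true≢false (cong (λ m → Maybe.is-just m) (trans e (sortNubL-dup (Vec.toList v) 2≤))))

    adjacentAt-dup : ∀ {n} j (v : Vec A n) {a} → adjacentAt j v ≡ just (a , a) → 2 ≤ cnt (eq a) (Vec.toList v)
    adjacentAt-dup zero (a ∷ .a ∷ v) refl rewrite cnt-eq-self a (a ∷ Vec.toList v) | cnt-eq-self a (Vec.toList v) =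
      s≤s (s≤s z≤n)
    adjacentAt-dup (suc j) (c ∷ v) {a} e = ℕ.≤-trans (adjacentAt-dup j v e) (cnt-≤-cons (eq a) c (Vec.toList v))

    invL-swapAt : ∀ {n} j (l : Vec A n) {a b} → adjacentAt j l ≡ just (a , b) → lt b a ≡ true →
                  suc (invL (Vec.toList (swapAt j l))) ≡ invL (Vec.toList l)
    invL-swapAt zero (a ∷ b ∷ m) refl b<a
      rewrite cnt-cons (λ z → lt z b) a (Vec.toList m) | cnt-cons (λ z → lt z a) b (Vec.toList m)
            | lt-asym b<a | b<a
      = cong suc (+-exchange (cnt (λ z → lt z b) (Vec.toList m)) (cnt (λ z → lt z a) (Vec.toList m)) (invL (Vec.toList m)))
      where
      +-exchange : ∀ p q s → p + (q + s) ≡ q + (p + s)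
      +-exchange = solve-∀
    invL-swapAt (suc j) (c ∷ m) e b<a rewrite cnt-↭ (λ z → lt z c) (swapAt-↭ j m) =
      trans (sym (ℕ.+-suc (cnt (λ z → lt z c) (Vec.toList m)) _))
            (cong (cnt (λ z → lt z c) (Vec.toList m) +_) (invL-swapAt j m e b<a))

    Unsorted : ∀ {n} → Vec A n → Set
    Unsorted l = ∃ λ j → Σ A λ a → Σ A λ b → adjacentAt j l ≡ just (a , b) × (a ≡ b ⊎ lt b a ≡ true)

    sorted-or-unsorted : ∀ {n} (l : Vec A n) → Sorted (Vec.toList l) ⊎ Unsorted l
    sorted-or-unsorted [] = inj₁ []
    sorted-or-unsorted (a ∷ []) = inj₁ [-]
    sorted-or-unsorted (a ∷ b ∷ m) with compare a b | sorted-or-unsorted (b ∷ m)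
    ... | equal a≡b | _ = inj₂ (0 , a , b , refl , inj₁ a≡b)
    ... | greater _ b<a _ _ | _ = inj₂ (0 , a , b , refl , inj₂ b<a)
    ... | less a<b _ _ _ | inj₁ s = inj₁ (a<b ∷ s)
    ... | less _ _ _ _ | inj₂ (j , a' , b' , e , bad) = inj₂ (suc j , a' , b' , e , bad)

  allFin-sorted : ∀ n → StrictOrderᵇ.Sorted (Fin-isStrictTotalOrderᵇ {n}) (List.allFin n)
  allFin-sorted zero = []
  allFin-sorted (suc n) = subst (λ l → StrictOrderᵇ.Sorted Fin-isStrictTotalOrderᵇ (Fin.zero ∷ l))
                                (List.map-tabulate (λ i → i) Fin.suc)
                                (zero-below (List.allFin n) (Linked.map⁺ (allFin-sorted n)))
    where
    zero-below : ∀ (l : List (Fin n)) → StrictOrderᵇ.Sorted Fin-isStrictTotalOrderᵇ (List.map Fin.suc l) →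
                 StrictOrderᵇ.Sorted Fin-isStrictTotalOrderᵇ (Fin.zero ∷ List.map Fin.suc l)
    zero-below [] _ = [-]
    zero-below (_ ∷ _) s = refl ∷ s

  occ-allFin : ∀ {n} (a : Fin n) → occ a (List.allFin n) ≡ 1
  occ-allFin {n} a = ℕ.≤-antisym (StrictOrderᵇ.sorted-cnt≤1 Fin-isStrictTotalOrderᵇ a (allFin-sorted n))
                                 (StrictOrderᵇ.∈⇒1≤cnt Fin-isStrictTotalOrderᵇ (∈-allFin a))

module RearrangementSigns where

  open import Data.Bool using (Bool; true; false; not; _∧_; _xor_)
  open import Data.Bool.Properties using (not-distribˡ-xor; not-distribʳ-xor; xor-same; xor-comm; xor-identityʳ)
  open import Data.Bool.Solver using (module xor-∧-Solver)
  open import Data.Empty using (⊥-elim)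
  open import Data.Fin as Fin using (Fin; toℕ)
  open import Data.List as List using (List; []; _∷_; _++_; length)
  open import Data.List.Properties using (length-drop)
  open import Data.List.Relation.Binary.Permutation.Propositional using (_↭_; prep; ↭-refl)
  import Data.List.Relation.Binary.Permutation.Propositional.Properties as ↭
  open import Data.List.Relation.Unary.All using (All; []; _∷_)
  open import Data.List.Relation.Unary.AllPairs using (AllPairs; []; _∷_)
  open import Data.Maybe using (just)
  open import Data.Nat using (ℕ; zero; suc; _+_; _*_; _∸_; _≡ᵇ_; _≤_; _<_; z≤n; s≤s)
  import Data.Nat.Properties as ℕ
  open import Data.Nat.Tactic.RingSolver using (solve-∀)
  open import Data.Product using (_,_)
  open import Data.Vec as Vec using (Vec; []; _∷_)
  open import Data.Vec.Properties using (length-toList)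
  open import Function using (_∘_)
  open import Relation.Binary.PropositionalEquality
  open ≡-Reasoning

  open Orders

  par : ℕ → Bool
  par zero = false
  par (suc n) = not (par n)

  par-+ : ∀ m n → par (m + n) ≡ par m xor par n
  par-+ zero n = refl
  par-+ (suc m) n rewrite par-+ m n = not-distribˡ-xor (par m) (par n)

  par-b2n : ∀ b → par (b2n b) ≡ b
  par-b2n true = refl
  par-b2n false = refl

  par-2* : ∀ n → par (2 * n) ≡ false
  par-2* n rewrite ℕ.+-identityʳ n = trans (par-+ n n) (xor-same (par n))

  par-shift : ∀ m u n v → m + u ≡ n + v → par m ≡ par n xor (par u xor par v)
  par-shift m u n v e = begin
    par m                        ≡⟨ solve 2 (λ a b → a := (a :+ b) :+ b) refl (par m) (par u) ⟩
    (par m xor par u) xor par u  ≡⟨ cong (_xor par u) (trans (sym (par-+ m u)) (trans (cong par e) (par-+ n v))) ⟩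
    (par n xor par v) xor par u  ≡⟨ solve 3 (λ a b c → (a :+ b) :+ c := a :+ (c :+ b)) refl (par n) (par v) (par u) ⟩
    par n xor (par u xor par v)  ∎
    where open xor-∧-Solver

  pairCount : ∀ {a} {A : Set a} → (A → A → Bool) → List A → List A → ℕ
  pairCount R [] w = 0
  pairCount R (p ∷ u) w = cnt (R p) w + pairCount R u w

  pairCount-[]ʳ : ∀ {a} {A : Set a} (R : A → A → Bool) u → pairCount R u [] ≡ 0
  pairCount-[]ʳ R [] = refl
  pairCount-[]ʳ R (p ∷ u) = pairCount-[]ʳ R u

  pairCount-∷ʳ : ∀ {a} {A : Set a} (R : A → A → Bool) u q w →
                 pairCount R u (q ∷ w) ≡ cnt (λ p → R p q) u + pairCount R u w
  pairCount-∷ʳ R [] q w = refl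
  pairCount-∷ʳ R (p ∷ u) q w
    rewrite cnt-cons (R p) q w | cnt-cons (λ p → R p q) p u | pairCount-∷ʳ R u q w
    = exchange (b2n (R p q)) (cnt (R p) w) (cnt (λ p → R p q) u) (pairCount R u w)
    where
    exchange : ∀ a b c d → (a + b) + (c + d) ≡ (a + c) + (b + d)
    exchange = solve-∀

  pairCount-transpose : ∀ {a} {A : Set a} (R : A → A → Bool) u w →
                        pairCount R u w ≡ pairCount (λ q p → R p q) w u
  pairCount-transpose R u [] = pairCount-[]ʳ R u
  pairCount-transpose R u (q ∷ w) = trans (pairCount-∷ʳ R u q w) (cong (_ +_) (pairCount-transpose R u w))

  cnt-partition : ∀ {a} {A : Set a} (R₁ R₂ R₃ : A → A → Bool) →
                  (∀ p q → b2n (R₁ p q) + b2n (R₂ p q) + b2n (R₃ p q) ≡ 1) →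
                  ∀ p w → cnt (R₁ p) w + cnt (R₂ p) w + cnt (R₃ p) w ≡ length w
  cnt-partition R₁ R₂ R₃ one p [] = refl
  cnt-partition R₁ R₂ R₃ one p (q ∷ w)
    rewrite cnt-cons (R₁ p) q w | cnt-cons (R₂ p) q w | cnt-cons (R₃ p) q w = begin
    (b₁ + d₁) + (b₂ + d₂) + (b₃ + d₃)  ≡⟨ regroup b₁ d₁ b₂ d₂ b₃ d₃ ⟩
    (b₁ + b₂ + b₃) + (d₁ + d₂ + d₃)    ≡⟨ cong₂ _+_ (one p q) (cnt-partition R₁ R₂ R₃ one p w) ⟩
    suc (length w)                     ∎
    where
    b₁ = b2n (R₁ p q)
    b₂ = b2n (R₂ p q)
    b₃ = b2n (R₃ p q)
    d₁ = cnt (R₁ p) w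
    d₂ = cnt (R₂ p) w
    d₃ = cnt (R₃ p) w
    regroup : ∀ a b c d e f → (a + b) + (c + d) + (e + f) ≡ (a + c + e) + (b + d + f)
    regroup = solve-∀

  pairCount-partition : ∀ {a} {A : Set a} (R₁ R₂ R₃ : A → A → Bool) →
                        (∀ p q → b2n (R₁ p q) + b2n (R₂ p q) + b2n (R₃ p q) ≡ 1) →
                        ∀ u w → pairCount R₁ u w + pairCount R₂ u w + pairCount R₃ u w ≡ length u * length w
  pairCount-partition R₁ R₂ R₃ one [] w = refl
  pairCount-partition R₁ R₂ R₃ one (p ∷ u) w = begin
    (c₁ + P₁) + (c₂ + P₂) + (c₃ + P₃)  ≡⟨ regroup c₁ P₁ c₂ P₂ c₃ P₃ ⟩
    (c₁ + c₂ + c₃) + (P₁ + P₂ + P₃)    ≡⟨ cong₂ _+_ (cnt-partition R₁ R₂ R₃ one p w) (pairCount-partition R₁ R₂ R₃ one u w) ⟩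
    length w + length u * length w     ∎
    where
    c₁ = cnt (R₁ p) w
    c₂ = cnt (R₂ p) w
    c₃ = cnt (R₃ p) w
    P₁ = pairCount R₁ u w
    P₂ = pairCount R₂ u w
    P₃ = pairCount R₃ u w
    regroup : ∀ a b c d e f → (a + b) + (c + d) + (e + f) ≡ (a + c + e) + (b + d + f)
    regroup = solve-∀

  module _ {r : ℕ} where

    below : Fin r → List (Fin r) → ℕ
    below p = cnt (λ q → ltF q p)

    crossings : List (Fin r) → List (Fin r) → ℕ
    crossings = pairCount (λ p q → ltF q p)

    matches : List (Fin r) → List (Fin r) → ℕ
    matches = pairCount eqF

    crossings-++ʳ : ∀ u w L → crossings u (w ++ L) ≡ crossings u w + crossings u L
    crossings-++ʳ [] w L = refl
    crossings-++ʳ (p ∷ u) w L rewrite cnt-++ (λ q → ltF q p) w L | crossings-++ʳ u w L =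
      exchange (below p w) (below p L) (crossings u w) (crossings u L)
      where
      exchange : ∀ a b c d → (a + b) + (c + d) ≡ (a + c) + (b + d)
      exchange = solve-∀

    inv-++ : ∀ u w → inv (u ++ w) ≡ inv u + crossings u w + inv w
    inv-++ [] w = refl
    inv-++ (p ∷ u) w rewrite cnt-++ (λ q → ltF q p) u w | inv-++ u w =
      regroup (below p u) (below p w) (inv u) (crossings u w) (inv w)
      where
      regroup : ∀ a b c d e → (a + b) + (c + d + e) ≡ a + c + (b + d) + e
      regroup = solve-∀

    inv-exchange : ∀ u w L → inv (u ++ w ++ L) + crossings w u ≡ inv (w ++ u ++ L) + crossings u w
    inv-exchange u w L
      rewrite inv-++ u (w ++ L) | inv-++ w (u ++ L) | inv-++ w L | inv-++ u L
            | crossings-++ʳ u w L | crossings-++ʳ w u L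
      = regroup (inv u) (crossings u w) (crossings u L) (inv w) (crossings w L) (inv L) (crossings w u)
      where
      regroup : ∀ a b c d e f g → a + (b + c) + (d + e + f) + g ≡ d + (g + e) + (a + c + f) + b
      regroup = solve-∀

    crossings-↭ʳ : ∀ u {w w'} → w ↭ w' → crossings u w ≡ crossings u w'
    crossings-↭ʳ [] w↭w' = refl
    crossings-↭ʳ (p ∷ u) w↭w' = cong₂ _+_ (cnt-↭ (λ q → ltF q p) w↭w') (crossings-↭ʳ u w↭w')

    inv-++-↭ : ∀ u {w w'} → w ↭ w' → inv w' ≡ 0 → inv (u ++ w) ≡ inv (u ++ w') + inv w
    inv-++-↭ u {w} {w'} w↭w' sorted rewrite inv-++ u w | inv-++ u w' | crossings-↭ʳ u w↭w' | sorted =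
      cong (_+ inv w) (sym (ℕ.+-identityʳ (inv u + crossings u w')))

    order-partition : ∀ (p q : Fin r) → b2n (ltF q p) + b2n (ltF p q) + b2n (eqF p q) ≡ 1
    order-partition p q with Fin-compare p q
    ... | less p<q q≮p p≢q _ rewrite p<q | q≮p | p≢q = refl
    ... | greater p≮q q<p p≢q _ rewrite p≮q | q<p | p≢q = refl
    ... | equal refl rewrite <ᵇ-false (ℕ.≤-refl {toℕ p}) | ≡ᵇ-refl (toℕ p) = refl

    crossings-both-ways : ∀ u w → crossings u w + crossings w u + matches u w ≡ length u * length w
    crossings-both-ways u w =
      trans (cong (λ c → crossings u w + c + matches u w) (pairCount-transpose (λ p q → ltF q p) w u))
            (pairCount-partition (λ p q → ltF q p) ltF eqF order-partition u w)

    crossings-parity : ∀ p q w → par (crossings (p ∷ q ∷ []) w + crossings w (p ∷ q ∷ [])) ≡ par (matches (p ∷ q ∷ []) w)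
    crossings-parity p q w = begin
      par C                          ≡⟨ solve 2 (λ c m → c := (c :+ m) :+ m) refl (par C) (par M) ⟩
      (par C xor par M) xor par M    ≡⟨ cong (_xor par M) (sym (par-+ C M)) ⟩
      par (C + M) xor par M          ≡⟨ cong (λ n → par n xor par M) (crossings-both-ways (p ∷ q ∷ []) w) ⟩
      par (2 * length w) xor par M   ≡⟨ cong (_xor par M) (par-2* (length w)) ⟩
      par M                          ∎
      where
      open xor-∧-Solver
      C = crossings (p ∷ q ∷ []) w + crossings w (p ∷ q ∷ [])
      M = matches (p ∷ q ∷ []) w

  module _ {r : ℕ} where

    ends : Edge r → List (Fin r)
    ends e = x e ∷ y e ∷ []

    sharedVertices : Edge r → Edge r → ℕ
    sharedVertices e f = b2n (eqF (x e) (x f)) + b2n (eqF (x e) (y f)) + b2n (eqF (y e) (x f)) + b2n (eqF (y e) (y f))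

    sharedVertices-sym : ∀ e f → sharedVertices e f ≡ sharedVertices f e
    sharedVertices-sym e f
      rewrite ≡ᵇ-sym (toℕ (x e)) (toℕ (x f)) | ≡ᵇ-sym (toℕ (x e)) (toℕ (y f))
            | ≡ᵇ-sym (toℕ (y e)) (toℕ (x f)) | ≡ᵇ-sym (toℕ (y e)) (toℕ (y f))
      = swap-middle (b2n (eqF (x f) (x e))) (b2n (eqF (y f) (x e))) (b2n (eqF (x f) (y e))) (b2n (eqF (y f) (y e)))
      where
      swap-middle : ∀ a b c d → a + b + c + d ≡ a + c + b + d
      swap-middle = solve-∀

    eqF-toℕ : ∀ (a b : Fin r) → eqF a b ≡ true → toℕ a ≡ toℕ b
    eqF-toℕ a b = cong toℕ ∘ eqF-sound

    sharedVertices≤1 : ∀ (e f : Edge r) → eqE e f ≡ false → sharedVertices e f ≤ 1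
    sharedVertices≤1 e f e≢f
      with eqF (x e) (x f) in xx | eqF (x e) (y f) in xy | eqF (y e) (x f) in yx | eqF (y e) (y f) in yy
    ... | false | false | false | false = z≤n
    ... | true  | false | false | false = ℕ.≤-refl
    ... | false | true  | false | false = ℕ.≤-refl
    ... | false | false | true  | false = ℕ.≤-refl
    ... | false | false | false | true  = ℕ.≤-refl
    ... | true  | true  | _     | _     = ⊥-elim (ℕ.<-irrefl (trans (sym (eqF-toℕ (x e) (x f) xx)) (eqF-toℕ (x e) (y f) xy)) (x<y f))
    ... | true  | _     | true  | _     = ⊥-elim (ℕ.<-irrefl (trans (eqF-toℕ (x e) (x f) xx) (sym (eqF-toℕ (y e) (x f) yx))) (x<y e))
    ... | true  | _     | _     | true  = ⊥-elim (true≢false e≢f)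
    ... | _     | true  | true  | _     =
          ⊥-elim (ℕ.<-asym (subst₂ _<_ (sym (eqF-toℕ (y e) (x f) yx)) (sym (eqF-toℕ (x e) (y f) xy)) (x<y f)) (x<y e))
    ... | _     | true  | _     | true  = ⊥-elim (ℕ.<-irrefl (trans (eqF-toℕ (x e) (y f) xy) (sym (eqF-toℕ (y e) (y f) yy))) (x<y e))
    ... | _     | _     | true  | true  = ⊥-elim (ℕ.<-irrefl (trans (sym (eqF-toℕ (y e) (x f) yx)) (eqF-toℕ (y e) (y f) yy)) (x<y f))

    b2n-commute : ∀ (e f : Edge r) → eqE e f ≡ false → b2n (commute e f) ≡ sharedVertices e f
    b2n-commute e f e≢f with sharedVertices e f | sharedVertices≤1 e f e≢f
    ... | zero | _ = refl
    ... | suc zero | _ = refl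
    ... | suc (suc _) | s≤s ()

    anticommute-sym : ∀ e f → anticommute e f ≡ anticommute f e
    anticommute-sym e f = cong (λ n → not (n ≡ᵇ 1)) (sharedVertices-sym e f)

    matches-ends-flat : ∀ {k} (e : Edge r) (m : Vec (Edge r) k) → All (λ f → eqE e f ≡ false) (Vec.toList m) →
                        matches (ends e) (flat m) ≡ cnt (commute e) (Vec.toList m)
    matches-ends-flat e [] [] = refl
    matches-ends-flat e (f ∷ m) (e≢f ∷ e≢m)
      rewrite cnt-cons (eqF (x e)) (x f) (y f ∷ flat m) | cnt-cons (eqF (x e)) (y f) (flat m)
            | cnt-cons (eqF (y e)) (x f) (y f ∷ flat m) | cnt-cons (eqF (y e)) (y f) (flat m)
            | cnt-cons (commute e) f (Vec.toList m) | b2n-commute e f e≢f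
            | sym (matches-ends-flat e m e≢m)
      = regroup (b2n (eqF (x e) (x f))) (b2n (eqF (x e) (y f))) (cnt (eqF (x e)) (flat m))
                (b2n (eqF (y e) (x f))) (b2n (eqF (y e) (y f))) (cnt (eqF (y e)) (flat m))
      where
      regroup : ∀ a b c d e f → a + (b + c) + (d + (e + f) + 0) ≡ a + b + d + e + (c + (f + 0))
      regroup = solve-∀

    inv-move-edge : ∀ {k} (e : Edge r) (m : Vec (Edge r) k) W → All (λ f → eqE e f ≡ false) (Vec.toList m) →
                    par (inv (flat m ++ ends e ++ W)) ≡ par (inv (ends e ++ flat m ++ W)) xor par (cnt (commute e) (Vec.toList m))
    inv-move-edge e m W e≢m = begin
      par (inv (flat m ++ ends e ++ W))
        ≡⟨ par-shift (inv (flat m ++ ends e ++ W)) (crossings (ends e) (flat m))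
                     (inv (ends e ++ flat m ++ W)) (crossings (flat m) (ends e)) (inv-exchange (flat m) (ends e) W) ⟩
      par (inv (ends e ++ flat m ++ W)) xor (par (crossings (ends e) (flat m)) xor par (crossings (flat m) (ends e)))
        ≡⟨ cong (par (inv (ends e ++ flat m ++ W)) xor_) (sym (par-+ (crossings (ends e) (flat m)) _)) ⟩
      par (inv (ends e ++ flat m ++ W)) xor par (crossings (ends e) (flat m) + crossings (flat m) (ends e))
        ≡⟨ cong (par (inv (ends e ++ flat m ++ W)) xor_)
                (trans (crossings-parity (x e) (y e) (flat m)) (cong par (matches-ends-flat e m e≢m))) ⟩
      par (inv (ends e ++ flat m ++ W)) xor par (cnt (commute e) (Vec.toList m)) ∎

    flat-swapAt-↭ : ∀ {n} j (es : Vec (Edge r) n) → flat (swapAt j es) ↭ flat es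
    flat-swapAt-↭ zero [] = ↭-refl
    flat-swapAt-↭ zero (a ∷ []) = ↭-refl
    flat-swapAt-↭ zero (a ∷ b ∷ m) = ↭.shifts (ends b) (ends a)
    flat-swapAt-↭ (suc j) [] = ↭-refl
    flat-swapAt-↭ (suc j) (c ∷ m) = prep (x c) (prep (y c) (flat-swapAt-↭ j m))

    flat-removeAt-↭ : ∀ {k} (m : Vec (Edge r) (suc k)) i W →
                      flat (Vec.removeAt m i) ++ ends (Vec.lookup m i) ++ W ↭ flat m ++ W
    flat-removeAt-↭ (e ∷ m) Fin.zero W = ↭.shifts (flat m) (ends e)
    flat-removeAt-↭ (e ∷ m@(_ ∷ _)) (Fin.suc i) W = prep (x e) (prep (y e) (flat-removeAt-↭ m i W))

    antiInversion : Edge r → Edge r → Bool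
    antiInversion e f = ltE f e ∧ anticommute e f

    antiInversion-xor : ∀ (a b : Edge r) → eqE a b ≡ false → antiInversion a b xor antiInversion b a ≡ anticommute a b
    antiInversion-xor a b a≢b with Edge-compare a b
    ... | less a<b b≮a _ _ rewrite b≮a | a<b | anticommute-sym b a = refl
    ... | greater a≮b b<a _ _ rewrite b<a | a≮b = xor-identityʳ (anticommute a b)
    ... | equal refl = ⊥-elim (true≢false (trans (sym (StrictOrderᵇ.eq-refl Edge-isStrictTotalOrderᵇ a)) a≢b))

    antiInv-transpose : ∀ (a b : Edge r) M →
      antiInv (b ∷ a ∷ M) + b2n (antiInversion a b) ≡ antiInv (a ∷ b ∷ M) + b2n (antiInversion b a)
    antiInv-transpose a b M rewrite cnt-cons (antiInversion b) a M | cnt-cons (antiInversion a) b M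
      = regroup (b2n (antiInversion b a)) (b2n (antiInversion a b)) (cnt (antiInversion b) M)
                (cnt (antiInversion a) M) (antiInv M)
      where
      regroup : ∀ ba ab cb ca i → (ba + cb) + (ca + i) + ab ≡ (ab + ca) + (cb + i) + ba
      regroup = solve-∀

    crossings-edges-parity : ∀ (a b : Edge r) → eqE a b ≡ false →
                             par (crossings (ends a) (ends b) + crossings (ends b) (ends a)) ≡ commute a b
    crossings-edges-parity a b a≢b = begin
      par (crossings (ends a) (ends b) + crossings (ends b) (ends a)) ≡⟨ crossings-parity (x a) (y a) (ends b) ⟩
      par (matches (ends a) (flat (b ∷ [])))                        ≡⟨ cong par (matches-ends-flat a (b ∷ []) (a≢b ∷ [])) ⟩
      par (cnt (commute a) (b ∷ []))                                ≡⟨ cong par (cnt-cons (commute a) b []) ⟩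
      par (b2n (commute a b) + 0)                                   ≡⟨ cong par (ℕ.+-identityʳ (b2n (commute a b))) ⟩
      par (b2n (commute a b))                                       ≡⟨ par-b2n (commute a b) ⟩
      commute a b                                                   ∎

    -- φ(es ⊗ vs) = (-1)^(signExponent es vs) · sorted es in C: inv is the exponent of sgn(γ),
    -- antiInv that of sorting the edges in C.
    signExponent : ∀ {n} → Vec (Edge r) n → List (Fin r) → ℕ
    signExponent es vs = antiInv (Vec.toList es) + inv (flat es ++ vs)

    headInversions : Edge r → List (Fin r) → ℕ
    headInversions e L = below (x e) (y e ∷ L) + below (y e) L

    inv-ends : ∀ e L → inv (ends e ++ L) ≡ headInversions e L + inv L
    inv-ends e L = sym (ℕ.+-assoc (below (x e) (y e ∷ L)) (below (y e) L) (inv L))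

    headInversions-↭ : ∀ e {L L'} → L ↭ L' → headInversions e L ≡ headInversions e L'
    headInversions-↭ e L↭L' = cong₂ _+_ (cnt-↭ (λ q → ltF q (x e)) (prep (y e) L↭L')) (cnt-↭ (λ q → ltF q (y e)) L↭L')

    headExponent : ∀ {n} → Edge r → Vec (Edge r) n → List (Fin r) → ℕ
    headExponent c m vs = cnt (antiInversion c) (Vec.toList m) + headInversions c (flat m ++ vs)

    signExponent-∷ : ∀ {n} c (m : Vec (Edge r) n) vs → signExponent (c ∷ m) vs ≡ headExponent c m vs + signExponent m vs
    signExponent-∷ c m vs = regroup (cnt (antiInversion c) (Vec.toList m)) (antiInv (Vec.toList m))
                                    (below (x c) (y c ∷ flat m ++ vs)) (below (y c) (flat m ++ vs)) (inv (flat m ++ vs))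
      where
      regroup : ∀ a b c d e → (a + b) + (c + (d + e)) ≡ (a + (c + d)) + (b + e)
      regroup = solve-∀

    headExponent-swapAt : ∀ {n} c j (m : Vec (Edge r) n) vs → headExponent c (swapAt j m) vs ≡ headExponent c m vs
    headExponent-swapAt c j m vs =
      cong₂ _+_ (cnt-↭ (antiInversion c) (swapAt-↭ j m)) (headInversions-↭ c (↭.++⁺ʳ vs (flat-swapAt-↭ j m)))

    signExponent-transpose : ∀ {n} (a b : Edge r) (m : Vec (Edge r) n) vs →
      signExponent (b ∷ a ∷ m) vs + (b2n (antiInversion a b) + crossings (ends a) (ends b))
        ≡ signExponent (a ∷ b ∷ m) vs + (b2n (antiInversion b a) + crossings (ends b) (ends a))
    signExponent-transpose a b m vs = begin
      A' + I' + (ra + cab)    ≡⟨ interchange A' I' ra cab ⟩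
      (A' + ra) + (I' + cab)  ≡⟨ cong₂ _+_ (antiInv-transpose a b (Vec.toList m)) (sym (inv-exchange (ends a) (ends b) (flat m ++ vs))) ⟩
      (A + rb) + (I + cba)    ≡⟨ interchange A I rb cba ⟨
      A + I + (rb + cba)      ∎
      where
      A' = antiInv (Vec.toList (b ∷ a ∷ m))
      I' = inv (flat (b ∷ a ∷ m) ++ vs)
      A = antiInv (Vec.toList (a ∷ b ∷ m))
      I = inv (flat (a ∷ b ∷ m) ++ vs)
      ra = b2n (antiInversion a b)
      rb = b2n (antiInversion b a)
      cab = crossings (ends a) (ends b)
      cba = crossings (ends b) (ends a)
      interchange : ∀ p q s t → (p + q) + (s + t) ≡ (p + s) + (q + t)
      interchange = solve-∀

    -- The parity of sgn(γ) changes by commute a b, that of the sign in C by anticommute a b.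
    transposition-parity : ∀ (a b : Edge r) → eqE a b ≡ false →
      par (b2n (antiInversion a b) + crossings (ends a) (ends b)) xor par (b2n (antiInversion b a) + crossings (ends b) (ends a))
        ≡ true
    transposition-parity a b a≢b
      rewrite par-+ (b2n (antiInversion a b)) (crossings (ends a) (ends b)) | par-+ (b2n (antiInversion b a)) (crossings (ends b) (ends a))
            | par-b2n (antiInversion a b) | par-b2n (antiInversion b a) = begin
      (antiInversion a b xor par cab) xor (antiInversion b a xor par cba)
        ≡⟨ solve 4 (λ p q s t → (p :+ s) :+ (q :+ t) := (p :+ q) :+ (s :+ t)) refl
                   (antiInversion a b) (antiInversion b a) (par cab) (par cba) ⟩
      (antiInversion a b xor antiInversion b a) xor (par cab xor par cba)
        ≡⟨ cong₂ _xor_ (antiInversion-xor a b a≢b) (trans (sym (par-+ cab cba)) (crossings-edges-parity a b a≢b)) ⟩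
      not (commute a b) xor commute a b
        ≡⟨ solve 1 (λ c → (con true :+ c) :+ c := con true) refl (commute a b) ⟩
      true ∎
      where
      open xor-∧-Solver
      cab = crossings (ends a) (ends b)
      cba = crossings (ends b) (ends a)

    signExponent-swapAt : ∀ {n} j (es : Vec (Edge r) n) vs {a b} → adjacentAt j es ≡ just (a , b) → eqE a b ≡ false →
                          par (signExponent (swapAt j es) vs) ≡ not (par (signExponent es vs))
    signExponent-swapAt zero (a ∷ b ∷ m) vs refl a≢b = begin
      par S'                                        ≡⟨ par-shift S' (ra + cab) S (rb + cba) (signExponent-transpose a b m vs) ⟩
      par S xor (par (ra + cab) xor par (rb + cba))  ≡⟨ cong (par S xor_) (transposition-parity a b a≢b) ⟩
      par S xor true                                 ≡⟨ xor-comm (par S) true ⟩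
      not (par S)                                    ∎
      where
      S' = signExponent (b ∷ a ∷ m) vs
      S = signExponent (a ∷ b ∷ m) vs
      ra = b2n (antiInversion a b)
      rb = b2n (antiInversion b a)
      cab = crossings (ends a) (ends b)
      cba = crossings (ends b) (ends a)
    signExponent-swapAt (suc j) (c ∷ m) vs e a≢b
      rewrite signExponent-∷ c (swapAt j m) vs | signExponent-∷ c m vs | headExponent-swapAt c j m vs
            | par-+ (headExponent c m vs) (signExponent (swapAt j m) vs) | par-+ (headExponent c m vs) (signExponent m vs)
            | signExponent-swapAt j m vs e a≢b
      = sym (not-distribʳ-xor (par (headExponent c m vs)) (par (signExponent m vs)))

    anticommuting-complement : ∀ {k} e (m : Vec (Edge r) k) →
                               k ∸ cnt (anticommute e) (Vec.toList m) ≡ cnt (commute e) (Vec.toList m)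
    anticommuting-complement {k} e m = begin
      k ∸ A                       ≡⟨ cong (_∸ A) (trans (sym (length-toList m)) (sym (cnt-complement (commute e) (Vec.toList m)))) ⟩
      cnt (commute e) M + A ∸ A   ≡⟨ ℕ.m+n∸n≡m (cnt (commute e) M) A ⟩
      cnt (commute e) M           ∎
      where
      M = Vec.toList m
      A = cnt (anticommute e) M

    cnt-drop≤ : ∀ {k} {A : Set} (p : A → Bool) (m : Vec A (suc k)) (i : Fin (suc k)) → cnt p (List.drop (suc (toℕ i)) (Vec.toList m)) ≤ k
    cnt-drop≤ {k} p m i = ℕ.≤-trans (cnt-≤-length p (List.drop (suc (toℕ i)) (Vec.toList m)))
      (subst (_≤ k) (sym (trans (length-drop (suc (toℕ i)) (Vec.toList m)) (cong (_∸ suc (toℕ i)) (length-toList m))))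
             (ℕ.m∸n≤m k (toℕ i)))

    par-suc-split : ∀ a h b → par (suc a + (h + b)) ≡ not (par h xor par (a + b))
    par-suc-split a h b rewrite par-+ a (h + b) | par-+ h b | par-+ a b =
      cong not (solve 3 (λ a h b → a :+ (h :+ b) := h :+ (a :+ b)) refl (par a) (par h) (par b))
      where open xor-∧-Solver

    -- The signs of the i-th terms of δ (left) and of ∂ (right), once the inversions are included.
    boundary-sign : ∀ {k} (es : Vec (Edge r) (suc k)) vs i → AllPairs (λ e f → eqE e f ≡ false) (Vec.toList es) →
      par (toℕ i + inv (flat (Vec.removeAt es i) ++ ends (Vec.lookup es i) ++ vs))
        ≡ par (k ∸ cnt (anticommute (Vec.lookup es i)) (List.drop (suc (toℕ i)) (Vec.toList es)) + inv (flat es ++ vs))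
    boundary-sign {k} (e ∷ m) vs Fin.zero (e≢m ∷ _) = begin
      par (inv (flat m ++ ends e ++ vs))             ≡⟨ inv-move-edge e m vs e≢m ⟩
      par (inv (ends e ++ flat m ++ vs)) xor par C   ≡⟨ xor-comm (par (inv (ends e ++ flat m ++ vs))) (par C) ⟩
      par C xor par (inv (ends e ++ flat m ++ vs))   ≡⟨ par-+ C (inv (ends e ++ flat m ++ vs)) ⟨
      par (C + inv (ends e ++ flat m ++ vs))         ≡⟨ cong (λ n → par (n + inv (ends e ++ flat m ++ vs)))
                                                             (anticommuting-complement e m) ⟨
      par (k ∸ cnt (anticommute e) (Vec.toList m) + inv (ends e ++ flat m ++ vs)) ∎
      where
      C = cnt (commute e) (Vec.toList m)
    boundary-sign {suc k} (e ∷ m@(_ ∷ _)) vs (Fin.suc i) (_ ∷ distinct) = begin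
      par (suc (toℕ i) + inv (ends e ++ L₁))                  ≡⟨ cong (λ n → par (suc (toℕ i) + n)) (inv-ends e L₁) ⟩
      par (suc (toℕ i) + (H L₁ + inv L₁))                     ≡⟨ par-suc-split (toℕ i) (H L₁) (inv L₁) ⟩
      not (par (H L₁) xor par (toℕ i + inv L₁))               ≡⟨ cong₂ (λ h n → not (h xor n))
                                                                       (cong par (headInversions-↭ e (flat-removeAt-↭ m i vs)))
                                                                       (boundary-sign m vs i distinct) ⟩
      not (par (H L₂) xor par (k ∸ A + inv L₂))               ≡⟨ par-suc-split (k ∸ A) (H L₂) (inv L₂) ⟨
      par (suc (k ∸ A) + (H L₂ + inv L₂))                     ≡⟨ cong₂ (λ a n → par (a + n)) (ℕ.+-∸-assoc 1 (cnt-drop≤ (anticommute (Vec.lookup m i)) m i))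
                                                                       (inv-ends e L₂) ⟨
      par (suc k ∸ A + inv (ends e ++ L₂))                    ∎
      where
      L₁ = flat (Vec.removeAt m i) ++ ends (Vec.lookup m i) ++ vs
      L₂ = flat m ++ vs
      H = headInversions e
      A = cnt (anticommute (Vec.lookup m i)) (List.drop (suc (toℕ i)) (Vec.toList m))

module Isomorphism {c ℓ} (R : CommutativeRing c ℓ) (r : ℕ) (lam : Fin r → ℕ) where

  import Algebra.Properties.Ring as RingProperties
  open import Data.Bool using (Bool; true; false; not; _∧_; _∨_; _xor_; if_then_else_)
  open import Data.Bool.ListAction using (and)
  open import Data.Bool.Properties using (not-involutive; xor-same; not-distribˡ-xor; T-≡; ∨-zeroʳ)
  open import Data.Empty using (⊥; ⊥-elim)
  open import Data.Fin as Fin using (Fin; toℕ)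
  open import Data.List as List using (List; []; _∷_; _++_)
  open import Data.List.Membership.Propositional.Properties using (∈-allFin)
  import Data.List.Properties as List
  open import Data.List.Relation.Binary.Permutation.Propositional using (_↭_; ↭-sym)
  import Data.List.Relation.Binary.Permutation.Propositional.Properties as ↭
  import Data.List.Relation.Unary.All as All
  open import Data.List.Relation.Unary.All.Properties using (all⁺; all⁻)
  import Data.List.Relation.Unary.AllPairs as AllPairs
  open import Data.List.Relation.Unary.Linked using ([]; _∷_)
  import Data.List.Relation.Unary.Linked.Properties as Linked
  open import Data.Maybe as Maybe using (Maybe; just; nothing)
  open import Data.Nat using (ℕ; zero; suc; _∸_; _<ᵇ_; _≡ᵇ_; _≤_; _<_; z≤n; s≤s) renaming (_+_ to _+ℕ_)
  import Data.Nat.Properties as ℕ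
  open import Data.Product using (Σ; _×_; _,_; proj₁; proj₂)
  open import Data.Sum using (_⊎_; inj₁; inj₂)
  open import Data.Vec as Vec using (Vec; []; _∷_)
  open import Function using (Equivalence; _∘_)
  open import Relation.Binary.PropositionalEquality as ≡ using (_≡_; _≢_; cong)
  open import Relation.Nullary using (¬_)
  open import Relation.Nullary.Decidable using (T?)

  open Orders
  open RearrangementSigns

  open CommutativeRing R hiding (zero)
  open RingProperties ring using (-‿distribˡ-*; -‿distribʳ-*; -0#≈0#; -‿involutive; -‿+-comm; ⁻¹-anti-homo‿-)
  open import Algebra.Properties.CommutativeSemigroup *-commutativeSemigroup using (x∙yz≈y∙xz)
  open import Relation.Binary.Reasoning.Setoid setoid
  open Complexes R r lam

  sgn-+ : ∀ m n → sgn (m +ℕ n) ≈ sgn m * sgn n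
  sgn-+ zero n = sym (*-identityˡ (sgn n))
  sgn-+ (suc m) n = trans (-‿cong (sgn-+ m n)) (-‿distribˡ-* (sgn m) (sgn n))

  sgnᵇ : Bool → Carrier
  sgnᵇ true = - 1#
  sgnᵇ false = 1#

  sgn≈sgnᵇ-par : ∀ n → sgn n ≈ sgnᵇ (par n)
  sgn≈sgnᵇ-par zero = refl
  sgn≈sgnᵇ-par (suc n) with par n | sgn≈sgnᵇ-par n
  ... | true | h = trans (-‿cong h) (-‿involutive 1#)
  ... | false | h = -‿cong h

  sgn-par : ∀ {m n} → par m ≡ par n → sgn m ≈ sgn n
  sgn-par {m} {n} e = trans (sgn≈sgnᵇ-par m) (trans (reflexive (cong sgnᵇ e)) (sym (sgn≈sgnᵇ-par n)))

  sgn-flip : ∀ {m n} → par m ≡ not (par n) → sgn m ≈ - sgn n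
  sgn-flip {m} {n} = sgn-par {m} {suc n}

  sgn*sgn : ∀ n → sgn n * sgn n ≈ 1#
  sgn*sgn n = trans (sym (sgn-+ n n)) (sgn-par {n +ℕ n} {0} (≡.trans (par-+ n n) (xor-same (par n))))

  ΣR-cong : ∀ {a} {A : Set a} {f g : A → Carrier} (l : List A) → (∀ u → f u ≈ g u) →
            ΣR (List.map f l) ≈ ΣR (List.map g l)
  ΣR-cong [] h = refl
  ΣR-cong (u ∷ l) h = +-cong (h u) (ΣR-cong l h)

  ΣR-*ʳ : ∀ {a} {A : Set a} (f : A → Carrier) u (l : List A) → ΣR (List.map (λ v → f v * u) l) ≈ ΣR (List.map f l) * u
  ΣR-*ʳ f u [] = sym (zeroˡ u)
  ΣR-*ʳ f u (v ∷ l) = trans (+-congˡ (ΣR-*ʳ f u l)) (sym (distribʳ u (f v) (ΣR (List.map f l))))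

  ΣR-neg : ∀ {a} {A : Set a} (f : A → Carrier) (l : List A) → ΣR (List.map (λ v → - f v) l) ≈ - ΣR (List.map f l)
  ΣR-neg f [] = sym -0#≈0#
  ΣR-neg f (v ∷ l) = trans (+-congˡ (ΣR-neg f l)) (-‿+-comm (f v) (ΣR (List.map f l)))

  ΣR-zero : ∀ {a} {A : Set a} {f : A → Carrier} (l : List A) → (∀ v → f v ≈ 0#) → ΣR (List.map f l) ≈ 0#
  ΣR-zero [] h = refl
  ΣR-zero (v ∷ l) h = trans (+-cong (h v) (ΣR-zero l h)) (+-identityˡ 0#)

  ΣR-allFin-suc : ∀ {n} (f : Fin (suc n) → Carrier) →
                  ΣR (List.map f (List.allFin (suc n))) ≡ f Fin.zero + ΣR (List.map (λ i → f (Fin.suc i)) (List.allFin n))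
  ΣR-allFin-suc {n} f = cong (λ l → f Fin.zero + ΣR l)
    (≡.trans (List.map-tabulate Fin.suc f) (≡.sym (List.map-tabulate (λ i → i) (λ i → f (Fin.suc i)))))

  -- Alternating functions

  module Alternation {A : Set} {eq lt : A → A → Bool} (O : IsStrictTotalOrderᵇ eq lt) where
    open StrictOrderᵇ O

    record Alternating {n} (Ψ : Vec A n → Carrier) : Set ℓ where
      field
        vanishes : ∀ j l a → adjacentAt j l ≡ just (a , a) → Ψ l ≈ 0#
        flips    : ∀ j l a b → adjacentAt j l ≡ just (a , b) → eq a b ≡ false → Ψ (swapAt j l) ≈ - Ψ l

    open Alternating public

    alternating-cong : ∀ {n} {Ψ₁ Ψ₂ : Vec A n → Carrier} → (∀ l → Ψ₁ l ≈ Ψ₂ l) → Alternating Ψ₁ → Alternating Ψ₂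
    alternating-cong {Ψ₁ = Ψ₁} {Ψ₂} h alt = record
      { vanishes = λ j l a e → trans (sym (h l)) (vanishes alt j l a e)
      ; flips    = λ j l a b e a≢b → trans (sym (h (swapAt j l))) (trans (flips alt j l a b e a≢b) (-‿cong (h l)))
      }

    alternating-*ˡ : ∀ {n} u {Ψ : Vec A n → Carrier} → Alternating Ψ → Alternating (λ l → u * Ψ l)
    alternating-*ˡ u alt = record
      { vanishes = λ j l a e → trans (*-congˡ (vanishes alt j l a e)) (zeroʳ u)
      ; flips    = λ j l a b e a≢b → trans (*-congˡ (flips alt j l a b e a≢b)) (sym (-‿distribʳ-* u _))
      }

    alternating-zero : ∀ {n} → Alternating {n} (λ _ → 0#)
    alternating-zero = record { vanishes = λ _ _ _ _ → refl ; flips = λ _ _ _ _ _ _ → sym -0#≈0# }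

    flips-back : ∀ {n} {Ψ : Vec A n → Carrier} → Alternating Ψ →
                 ∀ j l a b → adjacentAt j l ≡ just (a , b) → lt b a ≡ true → Ψ l ≈ - Ψ (swapAt j l)
    flips-back {Ψ = Ψ} alt j l a b e b<a =
      trans (reflexive (cong Ψ (≡.sym (swapAt-involutive j l e))))
            (flips alt j (swapAt j l) b a (adjacentAt-swapAt j l e) (lt⇒¬eq b<a))

    -- Bubble sort, by induction on the number of inversions.
    alternating-unique : ∀ {n} (P : Vec A n → Set) → (∀ j l → P l → P (swapAt j l)) →
                         {Ψ₁ Ψ₂ : Vec A n → Carrier} → Alternating Ψ₁ → Alternating Ψ₂ →
                         (∀ l → P l → Sorted (Vec.toList l) → Ψ₁ l ≈ Ψ₂ l) →
                         ∀ l → P l → Ψ₁ l ≈ Ψ₂ l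
    alternating-unique {n} P P-swap {Ψ₁} {Ψ₂} alt₁ alt₂ sorted-case l pl =
      go (suc (invL (Vec.toList l))) l ℕ.≤-refl pl
      where
      go : ∀ bound (l : Vec A n) → invL (Vec.toList l) < bound → P l → Ψ₁ l ≈ Ψ₂ l
      go (suc bound) l inv<bound pl with sorted-or-unsorted l
      ... | inj₁ s = sorted-case l pl s
      ... | inj₂ (j , a , .a , e , inj₁ ≡.refl) = trans (vanishes alt₁ j l a e) (sym (vanishes alt₂ j l a e))
      ... | inj₂ (j , a , b , e , inj₂ b<a) = begin
            Ψ₁ l                ≈⟨ flips-back alt₁ j l a b e b<a ⟩
            - Ψ₁ (swapAt j l)   ≈⟨ -‿cong (go bound (swapAt j l) fewer (P-swap j l pl)) ⟩
            - Ψ₂ (swapAt j l)   ≈⟨ flips-back alt₂ j l a b e b<a ⟨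
            Ψ₂ l                ∎
        where
        fewer : invL (Vec.toList (swapAt j l)) < bound
        fewer = ℕ.≤-pred (≡.subst (_≤ suc bound) (cong suc (≡.sym (invL-swapAt j l e b<a))) inv<bound)

    alternatingSum : ∀ {k} → (Vec A k → A → Carrier) → Vec A (suc k) → Carrier
    alternatingSum {k} Θ es = ΣR (List.map (λ i → sgn (toℕ i) * Θ (Vec.removeAt es i) (Vec.lookup es i)) (List.allFin (suc k)))

    shift : ∀ {k} → (Vec A (suc k) → A → Carrier) → A → Vec A k → A → Carrier
    shift Θ e m g = Θ (e ∷ m) g

    tailSum : ∀ {k} → (Vec A k → A → Carrier) → A → Vec A k → Carrier
    tailSum {zero} Θ e m = 0#
    tailSum {suc k} Θ e m = alternatingSum (shift Θ e) m

    alternatingSum-∷ : ∀ {k} (Θ : Vec A k → A → Carrier) e m → alternatingSum Θ (e ∷ m) ≈ Θ m e - tailSum Θ e m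
    alternatingSum-∷ {zero} Θ e [] = begin
      1# * Θ [] e + 0#   ≈⟨ +-cong (*-identityˡ (Θ [] e)) (sym -0#≈0#) ⟩
      Θ [] e - 0#        ∎
    alternatingSum-∷ {suc k} Θ e m@(_ ∷ _) = begin
      alternatingSum Θ (e ∷ m)
        ≡⟨ ΣR-allFin-suc (λ i → sgn (toℕ i) * Θ (Vec.removeAt (e ∷ m) i) (Vec.lookup (e ∷ m) i)) ⟩
      1# * Θ m e + ΣR (List.map (λ i → - sgn (toℕ i) * Θ (e ∷ Vec.removeAt m i) (Vec.lookup m i)) (List.allFin (suc k)))
        ≈⟨ +-cong (*-identityˡ (Θ m e)) (ΣR-cong (List.allFin (suc k)) (λ i → sym (-‿distribˡ-* _ _))) ⟩
      Θ m e + ΣR (List.map (λ i → - (sgn (toℕ i) * Θ (e ∷ Vec.removeAt m i) (Vec.lookup m i))) (List.allFin (suc k)))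
        ≈⟨ +-congˡ (ΣR-neg (λ i → sgn (toℕ i) * Θ (e ∷ Vec.removeAt m i) (Vec.lookup m i)) (List.allFin (suc k))) ⟩
      Θ m e - tailSum Θ e m ∎

    tailSum-repeat : ∀ {k} (Θ : Vec A (suc k) → A → Carrier) → (∀ g → Alternating (λ m → Θ m g)) →
                     ∀ e m → tailSum (shift Θ e) e m ≈ 0#
    tailSum-repeat {zero} Θ alt e m = refl
    tailSum-repeat {suc k} Θ alt e m = ΣR-zero (List.allFin (suc k)) (λ i →
      trans (*-congˡ (vanishes (alt _) zero (e ∷ e ∷ Vec.removeAt m i) e ≡.refl)) (zeroʳ _))

    tailSum-swap : ∀ {k} (Θ : Vec A (suc k) → A → Carrier) → (∀ g → Alternating (λ m → Θ m g)) →
                   ∀ e f → eq e f ≡ false → ∀ m →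
                   tailSum (shift Θ f) e m ≈ - tailSum (shift Θ e) f m
    tailSum-swap {zero} Θ alt e f e≢f m = sym -0#≈0#
    tailSum-swap {suc k} Θ alt e f e≢f m =
      trans (ΣR-cong (List.allFin (suc k)) (λ i →
               trans (*-congˡ (flips (alt _) zero (e ∷ f ∷ Vec.removeAt m i) e f ≡.refl e≢f)) (sym (-‿distribʳ-* _ _))))
            (ΣR-neg (λ i → sgn (toℕ i) * Θ (e ∷ f ∷ Vec.removeAt m i) (Vec.lookup m i)) (List.allFin (suc k)))

    shift-alternating : ∀ {k} {Θ : Vec A (suc k) → A → Carrier} → (∀ g → Alternating (λ m → Θ m g)) →
                        ∀ e g → Alternating (λ m → shift Θ e m g)
    shift-alternating alt e g = record
      { vanishes = λ j l a h → vanishes (alt g) (suc j) (e ∷ l) a h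
      ; flips    = λ j l a b h a≢b → flips (alt g) (suc j) (e ∷ l) a b h a≢b
      }

    sub-sub : ∀ p q t → p - (q - t) ≈ (p - q) + t
    sub-sub p q t = begin
      p + - (q + - t)        ≈⟨ +-congˡ (-‿+-comm q (- t)) ⟨
      p + (- q + - - t)      ≈⟨ +-congˡ (+-congˡ (-‿involutive t)) ⟩
      p + (- q + t)          ≈⟨ +-assoc p (- q) t ⟨
      (p - q) + t            ∎

    swap-sub : ∀ p q t → (p - q) - t ≈ - (q - (p - t))
    swap-sub p q t = sym (begin
      - (q - (p - t))        ≈⟨ -‿cong (sub-sub q p t) ⟩
      - ((q - p) + t)        ≈⟨ -‿+-comm (q - p) t ⟨
      - (q - p) - t          ≈⟨ +-congʳ (⁻¹-anti-homo‿- q p) ⟩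
      (p - q) - t            ∎)

    alternatingSum-repeat : ∀ {k} (Θ : Vec A (suc k) → A → Carrier) → (∀ g → Alternating (λ m → Θ m g)) →
                            ∀ e m → alternatingSum Θ (e ∷ e ∷ m) ≈ 0#
    alternatingSum-repeat Θ alt e m = begin
      alternatingSum Θ (e ∷ e ∷ m)                          ≈⟨ alternatingSum-∷ Θ e (e ∷ m) ⟩
      Θ (e ∷ m) e - alternatingSum (shift Θ e) (e ∷ m)      ≈⟨ +-congˡ (-‿cong (alternatingSum-∷ (shift Θ e) e m)) ⟩
      Θ (e ∷ m) e - (Θ (e ∷ m) e - tailSum (shift Θ e) e m) ≈⟨ sub-sub _ _ _ ⟩
      (Θ (e ∷ m) e - Θ (e ∷ m) e) + tailSum (shift Θ e) e m ≈⟨ +-cong (-‿inverseʳ _) (tailSum-repeat Θ alt e m) ⟩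
      0# + 0#                                               ≈⟨ +-identityˡ 0# ⟩
      0#                                                    ∎

    alternatingSum-transpose : ∀ {k} (Θ : Vec A (suc k) → A → Carrier) → (∀ g → Alternating (λ m → Θ m g)) →
                               ∀ e f → eq e f ≡ false → ∀ m → alternatingSum Θ (f ∷ e ∷ m) ≈ - alternatingSum Θ (e ∷ f ∷ m)
    alternatingSum-transpose Θ alt e f e≢f m = begin
      alternatingSum Θ (f ∷ e ∷ m)                                ≈⟨ alternatingSum-∷ Θ f (e ∷ m) ⟩
      Θ (e ∷ m) f - alternatingSum (shift Θ f) (e ∷ m)            ≈⟨ +-congˡ (-‿cong (alternatingSum-∷ (shift Θ f) e m)) ⟩
      Θ (e ∷ m) f - (Θ (f ∷ m) e - tailSum (shift Θ f) e m)       ≈⟨ sub-sub _ _ _ ⟩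
      (Θ (e ∷ m) f - Θ (f ∷ m) e) + tailSum (shift Θ f) e m       ≈⟨ +-congˡ (tailSum-swap Θ alt e f e≢f m) ⟩
      (Θ (e ∷ m) f - Θ (f ∷ m) e) - tailSum (shift Θ e) f m       ≈⟨ swap-sub _ _ _ ⟩
      - (Θ (f ∷ m) e - (Θ (e ∷ m) f - tailSum (shift Θ e) f m))   ≈⟨ -‿cong (+-congˡ (-‿cong (alternatingSum-∷ (shift Θ e) f m))) ⟨
      - (Θ (f ∷ m) e - alternatingSum (shift Θ e) (f ∷ m))        ≈⟨ -‿cong (alternatingSum-∷ Θ e (f ∷ m)) ⟨
      - alternatingSum Θ (e ∷ f ∷ m)                              ∎

    alternatingSum-alternating : ∀ {k} (Θ : Vec A k → A → Carrier) → (∀ g → Alternating (λ m → Θ m g)) →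
                                 Alternating (alternatingSum Θ)
    alternatingSum-alternating {zero} Θ alt = record
      { vanishes = λ { zero (e ∷ []) a () ; (suc zero) (e ∷ []) a () ; (suc (suc j)) (e ∷ []) a () }
      ; flips    = λ { zero (e ∷ []) a b () ; (suc zero) (e ∷ []) a b () ; (suc (suc j)) (e ∷ []) a b () }
      }
    alternatingSum-alternating {suc k} Θ alt = record { vanishes = vanish ; flips = flip }
      where
      tail-alt : ∀ e → Alternating (alternatingSum (shift Θ e))
      tail-alt e = alternatingSum-alternating (shift Θ e) (shift-alternating alt e)
      vanish : ∀ j l a → adjacentAt j l ≡ just (a , a) → alternatingSum Θ l ≈ 0#
      vanish zero (e ∷ .e ∷ m) .e ≡.refl = alternatingSum-repeat Θ alt e m
      vanish (suc j) (e ∷ m) a h = begin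
        alternatingSum Θ (e ∷ m)     ≈⟨ alternatingSum-∷ Θ e m ⟩
        Θ m e - tailSum Θ e m        ≈⟨ +-cong (vanishes (alt e) j m a h) (-‿cong (vanishes (tail-alt e) j m a h)) ⟩
        0# - 0#                      ≈⟨ -‿inverseʳ 0# ⟩
        0#                           ∎
      flip : ∀ j l a b → adjacentAt j l ≡ just (a , b) → eq a b ≡ false → alternatingSum Θ (swapAt j l) ≈ - alternatingSum Θ l
      flip zero (e ∷ f ∷ m) .e .f ≡.refl e≢f = alternatingSum-transpose Θ alt e f e≢f m
      flip (suc j) (e ∷ m) a b h a≢b = begin
        alternatingSum Θ (e ∷ swapAt j m)            ≈⟨ alternatingSum-∷ Θ e (swapAt j m) ⟩
        Θ (swapAt j m) e - tailSum Θ e (swapAt j m)   ≈⟨ +-cong (flips (alt e) j m a b h a≢b) (-‿cong (flips (tail-alt e) j m a b h a≢b)) ⟩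
        - Θ m e - - tailSum Θ e m                     ≈⟨ -‿+-comm (Θ m e) (- tailSum Θ e m) ⟩
        - (Θ m e - tailSum Θ e m)                     ≈⟨ -‿cong (alternatingSum-∷ Θ e m) ⟨
        - alternatingSum Θ (e ∷ m)                    ∎

  -- Coefficients as alternating functions of the edges

  open Alternation (Edge-isStrictTotalOrderᵇ {r})
  private
    module E = StrictOrderᵇ (Edge-isStrictTotalOrderᵇ {r})
    module V = StrictOrderᵇ (Fin-isStrictTotalOrderᵇ {r})

  normC-unfold : ∀ {k} (es : Vec (Edge r) k) →
    normC es ≡ (if degOK es then Maybe.map (sgn (antiInv (Vec.toList es)) ,_) (sortNubV eqE ltE es) else nothing)
  normC-unfold es with degOK es | sortNubV eqE ltE es
  ... | true | just _ = ≡.refl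
  ... | true | nothing = ≡.refl
  ... | false | _ = ≡.refl

  degOK-flat-↭ : ∀ {k} (es es' : Vec (Edge r) k) → flat es ↭ flat es' → degOK es ≡ degOK es'
  degOK-flat-↭ es es' p = cong and (List.map-cong (λ a →
    cong (λ n → (n ≡ᵇ (lam a ∸ 1)) ∨ (n ≡ᵇ lam a)) (cnt-↭ (eqF a) p)) (List.allFin r))

  normC-repeat : ∀ {k} j (es : Vec (Edge r) k) {a} → adjacentAt j es ≡ just (a , a) → normC es ≡ nothing
  normC-repeat j es {a} e rewrite normC-unfold es | E.sortNubV-dup es {a} (E.adjacentAt-dup j es {a} e) with degOK es
  ... | true = ≡.refl
  ... | false = ≡.refl

  sign-swapAt : ∀ {k} j (es : Vec (Edge r) k) W {a b} → adjacentAt j es ≡ just (a , b) → eqE a b ≡ false →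
    sgn (antiInv (Vec.toList (swapAt j es))) * sgn (inv (flat (swapAt j es) ++ W))
      ≈ - (sgn (antiInv (Vec.toList es)) * sgn (inv (flat es ++ W)))
  sign-swapAt j es W e a≢b = begin
    sgn A' * sgn I'    ≈⟨ sgn-+ A' I' ⟨
    sgn (A' +ℕ I')      ≈⟨ sgn-flip {A' +ℕ I'} {A +ℕ I} (signExponent-swapAt j es W e a≢b) ⟩
    - sgn (A +ℕ I)      ≈⟨ -‿cong (sgn-+ A I) ⟩
    - (sgn A * sgn I)  ∎
    where
    A' = antiInv (Vec.toList (swapAt j es))
    I' = inv (flat (swapAt j es) ++ W)
    A = antiInv (Vec.toList es)
    I = inv (flat es ++ W)

  -- Both the coefficients of φ(es ⊗ W) and of ∂(φ(es ⊗ W)) have this shape.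
  twisted-alternating : ∀ {k} W (F : Maybe (Carrier × Vec (Edge r) k) → Carrier → Carrier) →
    (∀ u → F nothing u ≈ 0#) → (G : Vec (Edge r) k → Carrier) → (∀ s u e' → F (just (s , e')) u ≈ G e' * (s * u)) →
    Alternating (λ es → F (normC es) (sgn (inv (flat es ++ W))))
  twisted-alternating W F F-nothing G F-just = record
    { vanishes = λ j es a e → ≡.subst (λ m → F m (sgn (inv (flat es ++ W))) ≈ 0#) (≡.sym (normC-repeat j es e)) (F-nothing _)
    ; flips = flip
    }
    where
    zero-flip : ∀ u u' → F nothing u ≈ - F nothing u'
    zero-flip u u' = trans (F-nothing u) (trans (sym -0#≈0#) (-‿cong (sym (F-nothing u'))))
    flip : ∀ j es a b → adjacentAt j es ≡ just (a , b) → eqE a b ≡ false →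
           F (normC (swapAt j es)) (sgn (inv (flat (swapAt j es) ++ W))) ≈ - F (normC es) (sgn (inv (flat es ++ W)))
    flip j es a b e a≢b
      rewrite normC-unfold es | normC-unfold (swapAt j es) | degOK-flat-↭ (swapAt j es) es (flat-swapAt-↭ j es)
            | E.sortNubV-↭ (swapAt-↭ j es)
      with degOK es | sortNubV eqE ltE es
    ... | false | _ = zero-flip _ _
    ... | true | nothing = zero-flip _ _
    ... | true | just e' = begin
          F (just (sgn A' , e')) (sgn I')   ≈⟨ F-just _ _ e' ⟩
          G e' * (sgn A' * sgn I')          ≈⟨ *-congˡ (sign-swapAt j es W e a≢b) ⟩
          G e' * - (sgn A * sgn I)          ≈⟨ -‿distribʳ-* (G e') _ ⟨
          - (G e' * (sgn A * sgn I))        ≈⟨ -‿cong (F-just _ _ e') ⟨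
          - F (just (sgn A , e')) (sgn I)   ∎
      where
      A' = antiInv (Vec.toList (swapAt j es))
      I' = inv (flat (swapAt j es) ++ W)
      A = antiInv (Vec.toList es)
      I = inv (flat es ++ W)

  coeffNF : ∀ {k} → Maybe (Carrier × Vec (Edge r) k) → Vec (Edge r) k → Carrier
  coeffNF (just (s , e')) b = if eqVecE e' b then s else 0#
  coeffNF nothing b = 0#

  coeffCgen-unfold : ∀ {k} (es b : Vec (Edge r) k) → coeffCgen es b ≡ coeffNF (normC es) b
  coeffCgen-unfold es b with normC es
  ... | just _ = ≡.refl
  ... | nothing = ≡.refl

  φ-coeff : ∀ {k} → List (Fin r) → Vec (Edge r) k → Vec (Edge r) k → Carrier
  φ-coeff vs b es = coeffCgen es b * sgn (inv (flat es ++ vs))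

  φ-coeff-alternating : ∀ {k} vs (b : Vec (Edge r) k) → Alternating (φ-coeff vs b)
  φ-coeff-alternating vs b =
    alternating-cong (λ es → *-congʳ (reflexive (≡.sym (coeffCgen-unfold es b))))
      (twisted-alternating vs (λ m u → coeffNF m b * u) zeroˡ (λ e' → if eqVecE e' b then 1# else 0#) just-case)
    where
    just-case : ∀ s u e' → coeffNF (just (s , e')) b * u ≈ (if eqVecE e' b then 1# else 0#) * (s * u)
    just-case s u e' with eqVecE e' b
    ... | true = trans (*-congʳ (sym (*-identityˡ s))) (*-assoc 1# s u)
    ... | false = trans (zeroˡ u) (sym (zeroˡ (s * u)))

  coeffNFX : ∀ {k} → Maybe (Vec (Edge r) k) → Maybe (List (Fin r)) → ℕ → Vec (Edge r) k × List (Fin r) → Carrier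
  coeffNFX (just es') (just vs') n (b , bv) = if eqVecE es' b ∧ eqListF vs' bv then sgn n else 0#
  coeffNFX _ _ n _ = 0#

  coeffXsym : ∀ {k} → Vec (Edge r) k → List (Fin r) → Vec (Edge r) k × List (Fin r) → Carrier
  coeffXsym es vs = coeffNFX (sortNubV eqE ltE es) (sortNubL eqF ltF vs) (invE (Vec.toList es) +ℕ inv vs)

  coeffXgen-unfold : ∀ {k} (g : XGen k) bb → coeffXgen g bb ≡ coeffXsym (proj₁ (proj₁ g)) (proj₂ (proj₁ g)) bb
  coeffXgen-unfold ((es , vs) , _) (b , bv) with sortNubV eqE ltE es | sortNubL eqF ltF vs
  ... | just _ | just _ = ≡.refl
  ... | just _ | nothing = ≡.refl
  ... | nothing | _ = ≡.refl

  invE-swapAt : ∀ {n} j (es : Vec (Edge r) n) {a b} → adjacentAt j es ≡ just (a , b) → eqE a b ≡ false →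
                par (invE (Vec.toList (swapAt j es))) ≡ not (par (invE (Vec.toList es)))
  invE-swapAt j es {a} {b} e a≢b with Edge-compare a b
  ... | equal ≡.refl = ⊥-elim (true≢false (≡.trans (≡.sym (E.eq-refl a)) a≢b))
  ... | greater _ b<a _ _ = ≡.trans (≡.sym (not-involutive _)) (cong not (cong par (E.invL-swapAt j es e b<a)))
  ... | less a<b _ _ _ = ≡.sym (≡.subst (λ l → not (par (invE (Vec.toList l))) ≡ par (invE (Vec.toList (swapAt j es))))
                              (swapAt-involutive j es e)
                              (cong par (E.invL-swapAt j (swapAt j es) (adjacentAt-swapAt j es e) a<b)))

  coeffXsym-alternating : ∀ {k} vs (bb : Vec (Edge r) k × List (Fin r)) → Alternating (λ es → coeffXsym es vs bb)
  coeffXsym-alternating vs (b , bv) = record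
    { vanishes = λ j es a e → reflexive (cong (λ m → coeffNFX m (sortNubL eqF ltF vs) (invE (Vec.toList es) +ℕ inv vs) (b , bv))
                                        (E.sortNubV-dup es {a} (E.adjacentAt-dup j es {a} e)))
    ; flips = flip
    }
    where
    flip : ∀ j es a b' → adjacentAt j es ≡ just (a , b') → eqE a b' ≡ false →
           coeffXsym (swapAt j es) vs (b , bv) ≈ - coeffXsym es vs (b , bv)
    flip j es a b' e a≢b' rewrite E.sortNubV-↭ (swapAt-↭ j es) with sortNubV eqE ltE es | sortNubL eqF ltF vs
    ... | nothing | _ = sym -0#≈0#
    ... | just _ | nothing = sym -0#≈0#
    ... | just es' | just vs' with eqVecE es' b ∧ eqListF vs' bv
    ...   | false = sym -0#≈0#
    ...   | true = sgn-flip {A' +ℕ inv vs} {A +ℕ inv vs} (≡.trans (par-+ A' (inv vs))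
                     (≡.trans (cong (_xor par (inv vs)) (invE-swapAt j es e a≢b'))
                       (≡.trans (≡.sym (not-distribˡ-xor (par A) (par (inv vs)))) (cong not (≡.sym (par-+ A (inv vs)))))))
      where
      A' = invE (Vec.toList (swapAt j es))
      A = invE (Vec.toList es)

  deg : ∀ {k} → Vec (Edge r) k → Fin r → ℕ
  deg es a = occ a (flat es)

  Fits : ∀ {k} → Vec (Edge r) k → List (Fin r) → Set
  Fits es vs = ∀ a → occ a (flat es ++ vs) ≡ lam a

  fits-split : ∀ {k} (es : Vec (Edge r) k) vs → Fits es vs → ∀ a → deg es a +ℕ occ a vs ≡ lam a
  fits-split es vs fits a = ≡.trans (≡.sym (cnt-++ (eqF a) (flat es) vs)) (fits a)

  fits-swapAt : ∀ {k} vs j (es : Vec (Edge r) k) → Fits es vs → Fits (swapAt j es) vs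
  fits-swapAt vs j es fits a = ≡.trans (cnt-↭ (eqF a) (↭.++⁺ʳ vs (flat-swapAt-↭ j es))) (fits a)

  DegreeOK : ∀ {k} → Vec (Edge r) k → Set
  DegreeOK es = ∀ a → deg es a ≡ lam a ∸ 1 ⊎ deg es a ≡ lam a

  allFinB-sound : ∀ (q : Fin r → Bool) → allFinB q ≡ true → ∀ a → q a ≡ true
  allFinB-sound q h a = Equivalence.to T-≡ (All.lookup (all⁺ q (List.allFin r) (Equivalence.from T-≡ h)) (∈-allFin a))

  allFinB-complete : ∀ (q : Fin r → Bool) → (∀ a → q a ≡ true) → allFinB q ≡ true
  allFinB-complete q h = Equivalence.to T-≡ (all⁻ q {xs = List.allFin r} (All.tabulate (λ {a} _ → Equivalence.from T-≡ (h a))))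

  degOK-sound : ∀ {k} (es : Vec (Edge r) k) → degOK es ≡ true → DegreeOK es
  degOK-sound es h a with deg es a ≡ᵇ (lam a ∸ 1) in e₁ | deg es a ≡ᵇ lam a in e₂ | allFinB-sound _ h a
  ... | true | _ | _ = inj₁ (≡ᵇ-sound e₁)
  ... | false | true | _ = inj₂ (≡ᵇ-sound e₂)

  degOK-complete : ∀ {k} (es : Vec (Edge r) k) → DegreeOK es → degOK es ≡ true
  degOK-complete es ok = allFinB-complete _ per
    where
    per : ∀ a → ((deg es a ≡ᵇ (lam a ∸ 1)) ∨ (deg es a ≡ᵇ lam a)) ≡ true
    per a with ok a
    ... | inj₁ e rewrite e | ≡ᵇ-refl (lam a ∸ 1) = ≡.refl
    ... | inj₂ e rewrite e | ≡ᵇ-refl (lam a) = ∨-zeroʳ _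

  ¬degreeOK⇒degOK-false : ∀ {k} (es : Vec (Edge r) k) → ¬ DegreeOK es → degOK es ≡ false
  ¬degreeOK⇒degOK-false es ¬ok with degOK es in e
  ... | true = ⊥-elim (¬ok (degOK-sound es e))
  ... | false = ≡.refl

  missing : ∀ {k} → Vec (Edge r) k → List (Fin r)
  missing es = List.filterᵇ (λ a → deg es a <ᵇ lam a) (List.allFin r)

  missing-sorted : ∀ {k} (es : Vec (Edge r) k) → V.Sorted (missing es)
  missing-sorted es = Linked.filter⁺ (T? ∘ (λ a → deg es a <ᵇ lam a)) (λ {a} {b} {c} → V.lt-trans {a} {b} {c}) (allFin-sorted r)

  occ-missing : ∀ {k} (es : Vec (Edge r) k) a → occ a (missing es) ≡ (if deg es a <ᵇ lam a then 1 else 0)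
  occ-missing es a rewrite V.cnt-filterᵇ (λ a → deg es a <ᵇ lam a) a (List.allFin r) | occ-allFin a = ≡.refl

  -- d is the degree of a vertex, v its multiplicity among the vertices and L its λ.

  fill-≤1 : ∀ d v L → d +ℕ v ≡ L → v ≤ 1 → v ≡ (if d <ᵇ L then 1 else 0)
  fill-≤1 d zero L ≡.refl _ rewrite ℕ.+-identityʳ d | <ᵇ-false (ℕ.≤-refl {d}) = ≡.refl
  fill-≤1 d (suc zero) L ≡.refl _ rewrite <ᵇ-true (≡.subst (d <_) (ℕ.+-comm 1 d) ℕ.≤-refl) = ≡.refl
  fill-≤1 d (suc (suc v)) L _ (s≤s ())

  fill⇒degree : ∀ d v L → d +ℕ v ≡ L → v ≤ 1 → d ≡ L ∸ 1 ⊎ d ≡ L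
  fill⇒degree d zero L ≡.refl _ = inj₂ (≡.sym (ℕ.+-identityʳ d))
  fill⇒degree d (suc zero) L ≡.refl _ = inj₁ (≡.sym (ℕ.m+n∸n≡m d 1))
  fill⇒degree d (suc (suc v)) L _ (s≤s ())

  overfill : ∀ d L → d +ℕ 2 ≤ L → d ≡ L ∸ 1 ⊎ d ≡ L → ⊥
  overfill d zero d+2≤ _ = ℕ.m+1+n≰m d (ℕ.≤-trans d+2≤ z≤n)
  overfill d (suc L) d+2≤ (inj₁ ≡.refl) = ℕ.m+1+n≰m d (ℕ.≤-pred (≡.subst (_≤ suc d) (ℕ.+-suc d 1) d+2≤))
  overfill d L d+2≤ (inj₂ ≡.refl) = ℕ.m+1+n≰m d d+2≤

  degree⇒fill : ∀ d L → 1 ≤ L → d ≡ L ∸ 1 ⊎ d ≡ L → d +ℕ (if d <ᵇ L then 1 else 0) ≡ L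
  degree⇒fill d (suc L) _ (inj₁ ≡.refl) rewrite <ᵇ-true (ℕ.≤-refl {suc L}) = ℕ.+-comm L 1
  degree⇒fill d L _ (inj₂ ≡.refl) rewrite <ᵇ-false (ℕ.≤-refl {d}) = ℕ.+-identityʳ d

  between⇒degree : ∀ d L → L ∸ 1 ≤ d → d ≤ L → d ≡ L ∸ 1 ⊎ d ≡ L
  between⇒degree d zero _ d≤0 = inj₂ (ℕ.n≤0⇒n≡0 d≤0)
  between⇒degree d (suc L) L≤d d≤L with ℕ.m≤n⇒m<n∨m≡n d≤L
  ... | inj₁ d<L = inj₁ (ℕ.≤-antisym (ℕ.≤-pred d<L) L≤d)
  ... | inj₂ d≡L = inj₂ d≡L

  missing-unique : ∀ {k} (es : Vec (Edge r) k) vs {vs'} → Fits es vs → sortNubL eqF ltF vs ≡ just vs' → vs' ≡ missing es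
  missing-unique es vs {vs'} fits h with V.sortNubL-sound vs h
  ... | vs'↭vs , sorted = V.sorted-unique sorted (missing-sorted es) λ a →
        ≡.trans (cnt-↭ (eqF a) vs'↭vs)
          (≡.trans (fill-≤1 (deg es a) (occ a vs) (lam a) (fits-split es vs fits a) (V.sortNubL-cnt≤1 vs h a))
                   (≡.sym (occ-missing es a)))

  fits⇒degreeOK : ∀ {k} (es : Vec (Edge r) k) vs → Fits es vs → (∀ a → occ a vs ≤ 1) → DegreeOK es
  fits⇒degreeOK es vs fits ≤1 a = fill⇒degree (deg es a) (occ a vs) (lam a) (fits-split es vs fits a) (≤1 a)

  fits-repeat⇒¬degreeOK : ∀ {k} (es : Vec (Edge r) k) vs a → Fits es vs → 2 ≤ occ a vs → ¬ DegreeOK es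
  fits-repeat⇒¬degreeOK es vs a fits 2≤ ok =
    overfill (deg es a) (lam a) (≡.subst (deg es a +ℕ 2 ≤_) (fits-split es vs fits a) (ℕ.+-monoʳ-≤ (deg es a) 2≤)) (ok a)

  deg-removeAt : ∀ {k} (es : Vec (Edge r) (suc k)) i a → deg (Vec.removeAt es i) a ≤ deg es a
  deg-removeAt es i a = ≡.subst (deg (Vec.removeAt es i) a ≤_)
    (≡.trans (≡.sym (cnt-++ (eqF a) (flat (Vec.removeAt es i)) _))
             (≡.trans (cnt-↭ (eqF a) (flat-removeAt-↭ es i [])) (cong (occ a) (List.++-identityʳ (flat es)))))
    (ℕ.m≤m+n _ _)

  degreeOK-removeAt : ∀ {k} (es : Vec (Edge r) (suc k)) vs i → Fits es vs → DegreeOK (Vec.removeAt es i) → DegreeOK es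
  degreeOK-removeAt es vs i fits ok a =
    between⇒degree (deg es a) (lam a) (ℕ.≤-trans lower (deg-removeAt es i a))
                   (≡.subst (deg es a ≤_) (fits-split es vs fits a) (ℕ.m≤m+n _ _))
    where
    lower : lam a ∸ 1 ≤ deg (Vec.removeAt es i) a
    lower with ok a
    ... | inj₁ e = ℕ.≤-reflexive (≡.sym e)
    ... | inj₂ e = ≡.subst (lam a ∸ 1 ≤_) (≡.sym e) (ℕ.m∸n≤m (lam a) 1)

  fits-missing : (∀ a → 1 ≤ lam a) → ∀ {k} (es : Vec (Edge r) k) → DegreeOK es → Fits es (missing es)
  fits-missing lam≥1 es ok a = ≡.trans (cnt-++ (eqF a) (flat es) (missing es))
    (≡.trans (cong (deg es a +ℕ_) (occ-missing es a)) (degree⇒fill (deg es a) (lam a) (lam≥1 a) (ok a)))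

  -- The coefficients of φ

  eqVecE-sound : ∀ {k} (u v : Vec (Edge r) k) → eqVecE u v ≡ true → u ≡ v
  eqVecE-sound [] [] _ = ≡.refl
  eqVecE-sound (e ∷ u) (f ∷ v) h with eqE e f in e≡f
  ... | true = ≡.cong₂ _∷_ (E.eq-sound e≡f) (eqVecE-sound u v h)
  ... | false = ⊥-elim (true≢false (≡.sym h))

  eqListF-sound : ∀ (u v : List (Fin r)) → eqListF u v ≡ true → u ≡ v
  eqListF-sound [] [] _ = ≡.refl
  eqListF-sound (a ∷ u) (b ∷ v) h with eqF a b in a≡b
  ... | true = ≡.cong₂ _∷_ (V.eq-sound a≡b) (eqListF-sound u v h)
  ... | false = ⊥-elim (true≢false (≡.sym h))

  eqListF-refl : ∀ (u : List (Fin r)) → eqListF u u ≡ true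
  eqListF-refl [] = ≡.refl
  eqListF-refl (a ∷ u) rewrite V.eq-refl a = eqListF-refl u

  antiInv-sorted : ∀ {k} (es : Vec (Edge r) k) → E.Sorted (Vec.toList es) → antiInv (Vec.toList es) ≡ 0
  antiInv-sorted es = E.pairsCount-sorted (λ e f → ltE f e ∧ anticommute e f) (λ {e} {f} e<f → cong (_∧ anticommute e f) (E.lt-asym {e} {f} e<f))

  invE-sorted : ∀ {k} (es : Vec (Edge r) k) → E.Sorted (Vec.toList es) → invE (Vec.toList es) ≡ 0
  invE-sorted es = E.pairsCount-sorted (λ e f → ltE f e) (λ {e} {f} → E.lt-asym {e} {f})

  inv-sorted : ∀ {l : List (Fin r)} → V.Sorted l → inv l ≡ 0
  inv-sorted = V.pairsCount-sorted (λ a b → ltF b a) (λ {a} {b} → V.lt-asym {a} {b})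

  -- φ(b ⊗ missing b) = σ b · b
  σ : ∀ {k} → Vec (Edge r) k → Carrier
  σ b = sgn (inv (flat b ++ missing b))

  φ-coeff-sorted : ∀ {k} vs (b es : Vec (Edge r) k) → Fits es vs → E.Sorted (Vec.toList es) →
                   φ-coeff vs b es ≈ σ b * coeffXsym es vs (b , missing b)
  φ-coeff-sorted vs b es fits sorted
    rewrite coeffCgen-unfold es b | normC-unfold es | E.sortNubV-sorted sorted | antiInv-sorted es sorted
          | invE-sorted es sorted
    with sortNubL eqF ltF vs in hv
  ... | nothing with V.sortNubL-nothing vs hv
  ...   | a , 2≤ rewrite ¬degreeOK⇒degOK-false es (fits-repeat⇒¬degreeOK es vs a fits 2≤) = trans (zeroˡ _) (sym (zeroʳ _))
  φ-coeff-sorted vs b es fits sorted | just vs'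
    rewrite degOK-complete es (fits⇒degreeOK es vs fits (V.sortNubL-cnt≤1 vs hv))
    with missing-unique es vs fits hv | V.sortNubL-sound vs hv
  ... | ≡.refl | vs'↭vs , _ with eqVecE es b in es≡b
  ...   | false = trans (zeroˡ _) (sym (zeroʳ _))
  ...   | true with eqVecE-sound es b es≡b
  ...     | ≡.refl rewrite eqListF-refl (missing es) = begin
            1# * sgn (inv (flat es ++ vs))                       ≈⟨ *-identityˡ _ ⟩
            sgn (inv (flat es ++ vs))                            ≡⟨ cong sgn (inv-++-↭ (flat es) (↭-sym vs'↭vs) (inv-sorted (missing-sorted es))) ⟩
            sgn (inv (flat es ++ missing es) +ℕ inv vs)          ≈⟨ sgn-+ (inv (flat es ++ missing es)) (inv vs) ⟩
            σ es * sgn (inv vs)                                  ∎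

  φ-coeff-formula : ∀ {k} vs (b es : Vec (Edge r) k) → Fits es vs → φ-coeff vs b es ≈ σ b * coeffXsym es vs (b , missing b)
  φ-coeff-formula vs b = alternating-unique (λ es → Fits es vs) (fits-swapAt vs) (φ-coeff-alternating vs b)
    (alternating-*ˡ (σ b) (coeffXsym-alternating vs (b , missing b))) (φ-coeff-sorted vs b)

  coeffXsym-sorted-off : ∀ {k} vs (b : Vec (Edge r) k) bv → bv ≢ missing b → (es : Vec (Edge r) k) → Fits es vs →
                         E.Sorted (Vec.toList es) → coeffXsym es vs (b , bv) ≈ 0#
  coeffXsym-sorted-off vs b bv bv≢ es fits sorted rewrite E.sortNubV-sorted sorted with sortNubL eqF ltF vs in hv
  ... | nothing = refl
  ... | just vs' with missing-unique es vs fits hv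
  ...   | ≡.refl with eqVecE es b in es≡b
  ...     | false = refl
  ...     | true with eqVecE-sound es b es≡b
  ...       | ≡.refl with eqListF (missing es) bv in e
  ...         | false = refl
  ...         | true = ⊥-elim (bv≢ (≡.sym (eqListF-sound (missing es) bv e)))

  coeffXsym-off : ∀ {k} vs (b : Vec (Edge r) k) bv → bv ≢ missing b → (es : Vec (Edge r) k) → Fits es vs →
                  coeffXsym es vs (b , bv) ≈ 0#
  coeffXsym-off vs b bv bv≢ = alternating-unique (λ es → Fits es vs) (fits-swapAt vs)
    (coeffXsym-alternating vs (b , bv)) alternating-zero (coeffXsym-sorted-off vs b bv bv≢)

  coeffC-φ : ∀ {k} (z : XElem k) (b : Vec (Edge r) k) → coeffC (φ z) b ≈ σ b * coeffX z (b , missing b)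
  coeffC-φ [] b = sym (zeroʳ (σ b))
  coeffC-φ ((a , g@((es , vs) , fits)) ∷ z) b = begin
    coeffCgen es b * (sgn (inv (flat es ++ vs)) * a) + coeffC (φ z) b
      ≈⟨ +-cong (sym (*-assoc _ _ a)) (coeffC-φ z b) ⟩
    φ-coeff vs b es * a + σ b * coeffX z (b , missing b)
      ≈⟨ +-congʳ (*-congʳ (φ-coeff-formula vs b es fits)) ⟩
    σ b * coeffXsym es vs (b , missing b) * a + σ b * coeffX z (b , missing b)
      ≈⟨ +-congʳ (trans (*-assoc _ _ a) (*-congˡ (*-congʳ (reflexive (≡.sym (coeffXgen-unfold g (b , missing b))))))) ⟩
    σ b * (coeffXgen g (b , missing b) * a) + σ b * coeffX z (b , missing b)
      ≈⟨ distribˡ (σ b) _ _ ⟨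
    σ b * coeffX ((a , g) ∷ z) (b , missing b) ∎

  coeffX-off : ∀ {k} (z : XElem k) (b : Vec (Edge r) k) bv → bv ≢ missing b → coeffX z (b , bv) ≈ 0#
  coeffX-off [] b bv bv≢ = refl
  coeffX-off ((a , g@((es , vs) , fits)) ∷ z) b bv bv≢ = begin
    coeffXgen g (b , bv) * a + coeffX z (b , bv) ≈⟨ +-cong (*-congʳ (reflexive (coeffXgen-unfold g (b , bv)))) (coeffX-off z b bv bv≢) ⟩
    coeffXsym es vs (b , bv) * a + 0#            ≈⟨ +-cong (*-congʳ (coeffXsym-off vs b bv bv≢ es fits)) refl ⟩
    0# * a + 0#                                  ≈⟨ +-cong (zeroˡ a) refl ⟩
    0# + 0#                                      ≈⟨ +-identityʳ 0# ⟩
    0#                                           ∎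

  σ-cancel : ∀ {k} (b : Vec (Edge r) k) u → σ b * (σ b * u) ≈ u
  σ-cancel b u = trans (sym (*-assoc _ _ u)) (trans (*-congʳ (sgn*sgn (inv (flat b ++ missing b)))) (*-identityˡ u))

  φ-wellDefined : ∀ {k} (z w : XElem k) → z ≈X w → φ z ≈C φ w
  φ-wellDefined z w z≈w b = trans (coeffC-φ z b) (trans (*-congˡ (z≈w (b , missing b))) (sym (coeffC-φ w b)))

  φ-injective : ∀ {k} (z w : XElem k) → φ z ≈C φ w → z ≈X w
  φ-injective z w φz≈φw (b , bv) with eqListF bv (missing b) in e
  ... | true with eqListF-sound bv (missing b) e
  ...   | ≡.refl = begin
          coeffX z (b , missing b)                 ≈⟨ σ-cancel b _ ⟨
          σ b * (σ b * coeffX z (b , missing b))   ≈⟨ *-congˡ (trans (sym (coeffC-φ z b)) (trans (φz≈φw b) (coeffC-φ w b))) ⟩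
          σ b * (σ b * coeffX w (b , missing b))   ≈⟨ σ-cancel b _ ⟩
          coeffX w (b , missing b)                 ∎
  φ-injective z w φz≈φw (b , bv) | false =
    trans (coeffX-off z b bv bv≢) (sym (coeffX-off w b bv bv≢))
    where
    bv≢ : bv ≢ missing b
    bv≢ ≡.refl = true≢false (≡.trans (≡.sym (eqListF-refl (missing b))) e)

  coeffCgen-¬degreeOK : ∀ {k} (es b : Vec (Edge r) k) → ¬ DegreeOK es → coeffCgen es b ≈ 0#
  coeffCgen-¬degreeOK es b ¬ok rewrite coeffCgen-unfold es b | normC-unfold es | ¬degreeOK⇒degOK-false es ¬ok = refl

  φ-surjective : (∀ a → 1 ≤ lam a) → ∀ {k} (u : CElem k) → Σ (XElem k) (λ z → φ z ≈C u)
  φ-surjective lam≥1 [] = [] , λ _ → refl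
  φ-surjective lam≥1 ((a , es) ∷ u) = extend (degOK es) ≡.refl (φ-surjective lam≥1 u)
    where
    extend : ∀ t → degOK es ≡ t → Σ (XElem _) (λ z → φ z ≈C u) → Σ (XElem _) (λ z → φ z ≈C ((a , es) ∷ u))
    extend true ok (z , φz≈u) = (σ es * a , ((es , missing es) , fits-missing lam≥1 es (degOK-sound es ok))) ∷ z ,
                                λ b → +-cong (*-congˡ (σ-cancel es a)) (φz≈u b)
    extend false ok (z , φz≈u) = z , λ b → begin
      coeffC (φ z) b                  ≈⟨ φz≈u b ⟩
      coeffC u b                      ≈⟨ +-identityˡ _ ⟨
      0# + coeffC u b                 ≈⟨ +-congʳ (trans (sym (zeroˡ a)) (*-congʳ (sym (coeffCgen-¬degreeOK es b ¬ok)))) ⟩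
      coeffCgen es b * a + coeffC u b ∎
      where
      ¬ok : ¬ DegreeOK es
      ¬ok d = true≢false (≡.trans (≡.sym (degOK-complete es d)) ok)

  -- φ is a chain map

  coeffC-++ : ∀ {k} (z w : CElem k) b → coeffC (z ++ w) b ≈ coeffC z b + coeffC w b
  coeffC-++ [] w b = sym (+-identityˡ _)
  coeffC-++ ((u , es) ∷ z) w b = trans (+-congˡ (coeffC-++ z w b)) (sym (+-assoc _ _ _))

  coeffC-map : ∀ {a} {I : Set a} {k} (f : I → Carrier × Vec (Edge r) k) l b →
               coeffC (List.map f l) b ≡ ΣR (List.map (λ i → coeffCgen (proj₂ (f i)) b * proj₁ (f i)) l)
  coeffC-map f l b = cong ΣR (≡.sym (List.map-∘ l))

  ∂sign : ∀ {k} → Vec (Edge r) (suc k) → Fin (suc k) → Carrier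
  ∂sign {k} e' j = sgn (k ∸ cnt (anticommute (Vec.lookup e' j)) (List.drop (suc (toℕ j)) (Vec.toList e')))

  ∂-coeff : ∀ {k} → Vec (Edge r) k → Vec (Edge r) (suc k) → Carrier
  ∂-coeff {k} b' e' = ΣR (List.map (λ j → coeffCgen (Vec.removeAt e' j) b' * ∂sign e' j) (List.allFin (suc k)))

  ∂-coeffNF : ∀ {k} → Vec (Edge r) k → Maybe (Carrier × Vec (Edge r) (suc k)) → Carrier → Carrier
  ∂-coeffNF b' (just (s , e')) u = ∂-coeff b' e' * (s * u)
  ∂-coeffNF b' nothing u = 0#

  coeffC-∂-single : ∀ {k} (b' : Vec (Edge r) k) u es → coeffC (∂ ((u , es) ∷ [])) b' ≈ ∂-coeffNF b' (normC es) u
  coeffC-∂-single {k} b' u es with normC es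
  ... | nothing = refl
  ... | just (s , e') = begin
    coeffC (List.map scale (List.map term A) ++ []) b'
      ≡⟨ cong (λ l → coeffC l b') (List.++-identityʳ (List.map scale (List.map term A))) ⟩
    coeffC (List.map scale (List.map term A)) b'
      ≡⟨ cong (λ l → coeffC l b') (≡.sym (List.map-∘ A)) ⟩
    coeffC (List.map (scale ∘ term) A) b'
      ≡⟨ coeffC-map (scale ∘ term) A b' ⟩
    ΣR (List.map (λ j → coeffCgen (Vec.removeAt e' j) b' * (∂sign e' j * (s * u))) A)
      ≈⟨ ΣR-cong A (λ j → sym (*-assoc _ _ _)) ⟩
    ΣR (List.map (λ j → coeffCgen (Vec.removeAt e' j) b' * ∂sign e' j * (s * u)) A)
      ≈⟨ ΣR-*ʳ (λ j → coeffCgen (Vec.removeAt e' j) b' * ∂sign e' j) (s * u) A ⟩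
    ∂-coeff b' e' * (s * u) ∎
    where
    A = List.allFin (suc k)
    scale : Carrier × Vec (Edge r) k → Carrier × Vec (Edge r) k
    scale (t , h) = t * (s * u) , h
    term : Fin (suc k) → Carrier × Vec (Edge r) k
    term j = ∂sign e' j , Vec.removeAt e' j

  ∂φ-coeff : ∀ {k} → List (Fin r) → Vec (Edge r) k → Vec (Edge r) (suc k) → Carrier
  ∂φ-coeff vs b' es = ∂-coeffNF b' (normC es) (sgn (inv (flat es ++ vs)))

  ∂φ-coeff-alternating : ∀ {k} vs (b' : Vec (Edge r) k) → Alternating (∂φ-coeff vs b')
  ∂φ-coeff-alternating vs b' = twisted-alternating vs (∂-coeffNF b') (λ _ → refl) (∂-coeff b') (λ _ _ _ → refl)

  -- φ(δ(es ⊗ vs)) has coefficient alternatingSum (φδ-term vs b') es at b'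
  φδ-term : ∀ {k} → List (Fin r) → Vec (Edge r) k → Vec (Edge r) k → Edge r → Carrier
  φδ-term vs b' m e = φ-coeff (ends e ++ vs) b' m

  coeffC-φδ-single : ∀ {k} (b' : Vec (Edge r) k) a (g : XGen (suc k)) →
    coeffC (φ (δ ((a , g) ∷ []))) b' ≈ alternatingSum (φδ-term (proj₂ (proj₁ g)) b') (proj₁ (proj₁ g)) * a
  coeffC-φδ-single {k} b' a g@((es , vs) , fits) = begin
    coeffC (List.map φgen (List.map scale (List.map term A) ++ [])) b'
      ≡⟨ cong (λ l → coeffC (List.map φgen l) b') (List.++-identityʳ (List.map scale (List.map term A))) ⟩
    coeffC (List.map φgen (List.map scale (List.map term A))) b'
      ≡⟨ cong (λ l → coeffC l b') (≡.trans (cong (List.map φgen) (≡.sym (List.map-∘ A))) (≡.sym (List.map-∘ A))) ⟩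
    coeffC (List.map (φgen ∘ scale ∘ term) A) b'
      ≡⟨ coeffC-map (φgen ∘ scale ∘ term) A b' ⟩
    ΣR (List.map (λ i → coeffCgen (Vec.removeAt es i) b' * (sgn (I i) * (sgn (toℕ i) * a))) A)
      ≈⟨ ΣR-cong A (λ i → regroup (coeffCgen (Vec.removeAt es i) b') (sgn (I i)) (sgn (toℕ i)) a) ⟩
    ΣR (List.map (λ i → sgn (toℕ i) * φδ-term vs b' (Vec.removeAt es i) (Vec.lookup es i) * a) A)
      ≈⟨ ΣR-*ʳ (λ i → sgn (toℕ i) * φδ-term vs b' (Vec.removeAt es i) (Vec.lookup es i)) a A ⟩
    alternatingSum (φδ-term vs b') es * a ∎
    where
    A = List.allFin (suc k)
    I : Fin (suc k) → ℕ
    I i = inv (flat (Vec.removeAt es i) ++ ends (Vec.lookup es i) ++ vs)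
    term : Fin (suc k) → Carrier × XGen k
    term i = sgn (toℕ i) , ((Vec.removeAt es i , ends (Vec.lookup es i) ++ vs) ,
                            λ v → ≡.trans (occ-remove v es i vs) (fits v))
    scale : Carrier × XGen k → Carrier × XGen k
    scale (s , h) = s * a , h
    φgen : Carrier × XGen k → Carrier × Vec (Edge r) k
    φgen (c , ((es' , vs') , _)) = sgn (inv (flat es' ++ vs')) * c , es'
    regroup : ∀ c s t a → c * (s * (t * a)) ≈ t * (c * s) * a
    regroup c s t a = trans (sym (*-assoc c s (t * a))) (trans (sym (*-assoc (c * s) t a)) (*-congʳ (*-comm (c * s) t)))

  normC-sorted : ∀ {k} (es : Vec (Edge r) k) → degOK es ≡ true → E.Sorted (Vec.toList es) → normC es ≡ just (1# , es)
  normC-sorted es ok sorted rewrite normC-unfold es | ok | E.sortNubV-sorted sorted | antiInv-sorted es sorted = ≡.refl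

  normC-¬degOK : ∀ {k} (es : Vec (Edge r) k) → degOK es ≡ false → normC es ≡ nothing
  normC-¬degOK es ¬ok rewrite normC-unfold es | ¬ok = ≡.refl

  boundary-sgn : ∀ {k} (es : Vec (Edge r) (suc k)) vs i → E.Sorted (Vec.toList es) →
    sgn (toℕ i) * sgn (inv (flat (Vec.removeAt es i) ++ ends (Vec.lookup es i) ++ vs)) ≈ ∂sign es i * sgn (inv (flat es ++ vs))
  boundary-sgn {k} es vs i sorted = begin
    sgn (toℕ i) * sgn I     ≈⟨ sgn-+ (toℕ i) I ⟨
    sgn (toℕ i +ℕ I)        ≈⟨ sgn-par {toℕ i +ℕ I} {η +ℕ J} (boundary-sign es vs i distinct) ⟩
    sgn (η +ℕ J)            ≈⟨ sgn-+ η J ⟩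
    ∂sign es i * sgn J      ∎
    where
    I = inv (flat (Vec.removeAt es i) ++ ends (Vec.lookup es i) ++ vs)
    J = inv (flat es ++ vs)
    η = k ∸ cnt (anticommute (Vec.lookup es i)) (List.drop (suc (toℕ i)) (Vec.toList es))
    distinct = AllPairs.map (λ {e} {f} → E.lt⇒¬eq {e} {f}) (E.sorted⇒allPairs sorted)

  φδ-coeff-sorted : ∀ {k} vs (b' : Vec (Edge r) k) (es : Vec (Edge r) (suc k)) → Fits es vs → E.Sorted (Vec.toList es) →
                    alternatingSum (φδ-term vs b') es ≈ ∂φ-coeff vs b' es
  φδ-coeff-sorted {k} vs b' es fits sorted = by-degOK (degOK es) ≡.refl
    where
    A = List.allFin (suc k)
    σe = sgn (inv (flat es ++ vs))
    cc : Fin (suc k) → Carrier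
    cc i = coeffCgen (Vec.removeAt es i) b'
    term : ∀ i → sgn (toℕ i) * φδ-term vs b' (Vec.removeAt es i) (Vec.lookup es i) ≈ cc i * ∂sign es i * (1# * σe)
    term i = begin
      sgn (toℕ i) * (cc i * sI)     ≈⟨ x∙yz≈y∙xz (sgn (toℕ i)) (cc i) sI ⟩
      cc i * (sgn (toℕ i) * sI)     ≈⟨ *-congˡ (boundary-sgn es vs i sorted) ⟩
      cc i * (∂sign es i * σe)      ≈⟨ *-assoc (cc i) (∂sign es i) σe ⟨
      cc i * ∂sign es i * σe        ≈⟨ *-congˡ (*-identityˡ σe) ⟨
      cc i * ∂sign es i * (1# * σe) ∎
      where
      sI = sgn (inv (flat (Vec.removeAt es i) ++ ends (Vec.lookup es i) ++ vs))
    by-degOK : ∀ t → degOK es ≡ t → alternatingSum (φδ-term vs b') es ≈ ∂φ-coeff vs b' es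
    by-degOK true ok = begin
      alternatingSum (φδ-term vs b') es                     ≈⟨ ΣR-cong A term ⟩
      ΣR (List.map (λ i → cc i * ∂sign es i * (1# * σe)) A) ≈⟨ ΣR-*ʳ (λ i → cc i * ∂sign es i) (1# * σe) A ⟩
      ∂-coeff b' es * (1# * σe)                             ≡⟨ cong (λ m → ∂-coeffNF b' m σe) (≡.sym (normC-sorted es ok sorted)) ⟩
      ∂φ-coeff vs b' es                                     ∎
    by-degOK false ok = begin
      alternatingSum (φδ-term vs b') es  ≈⟨ ΣR-zero A (λ i → trans (*-congˡ (trans (*-congʳ (coeffCgen-¬degreeOK _ b' (¬ok i)))
                                                                                   (zeroˡ _))) (zeroʳ _)) ⟩
      0#                                 ≡⟨ cong (λ m → ∂-coeffNF b' m σe) (≡.sym (normC-¬degOK es ok)) ⟩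
      ∂φ-coeff vs b' es                  ∎
      where
      ¬ok : ∀ i → ¬ DegreeOK (Vec.removeAt es i)
      ¬ok i d = true≢false (≡.trans (≡.sym (degOK-complete es (degreeOK-removeAt es vs i fits d))) ok)

  φδ-coeff : ∀ {k} vs (b' : Vec (Edge r) k) (es : Vec (Edge r) (suc k)) → Fits es vs →
             alternatingSum (φδ-term vs b') es ≈ ∂φ-coeff vs b' es
  φδ-coeff vs b' = alternating-unique (λ es → Fits es vs) (fits-swapAt vs)
    (alternatingSum-alternating (φδ-term vs b') (λ g → φ-coeff-alternating (ends g ++ vs) b'))
    (∂φ-coeff-alternating vs b') (φδ-coeff-sorted vs b')

  ∂-coeffNF-*ʳ : ∀ {k} (b' : Vec (Edge r) k) m u a → ∂-coeffNF b' m (u * a) ≈ ∂-coeffNF b' m u * a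
  ∂-coeffNF-*ʳ b' nothing u a = sym (zeroˡ a)
  ∂-coeffNF-*ʳ b' (just (s , e')) u a = trans (*-congˡ (sym (*-assoc s u a))) (sym (*-assoc _ _ a))

  φ-chain-generator : ∀ {k} (b' : Vec (Edge r) k) a (g : XGen (suc k)) →
                      coeffC (φ (δ ((a , g) ∷ []))) b' ≈ coeffC (∂ (φ ((a , g) ∷ []))) b'
  φ-chain-generator b' a g@((es , vs) , fits) = begin
    coeffC (φ (δ ((a , g) ∷ []))) b'                          ≈⟨ coeffC-φδ-single b' a g ⟩
    alternatingSum (φδ-term vs b') es * a                     ≈⟨ *-congʳ (φδ-coeff vs b' es fits) ⟩
    ∂φ-coeff vs b' es * a                                     ≈⟨ ∂-coeffNF-*ʳ b' (normC es) _ a ⟨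
    ∂-coeffNF b' (normC es) (sgn (inv (flat es ++ vs)) * a)  ≈⟨ coeffC-∂-single b' _ es ⟨
    coeffC (∂ (φ ((a , g) ∷ []))) b'                          ∎

  δ-∷ : ∀ {k} a (g : XGen (suc k)) z → δ ((a , g) ∷ z) ≡ δ ((a , g) ∷ []) ++ δ z
  δ-∷ {k} a g z = cong (_++ δ z) (≡.sym (List.++-identityʳ (List.map scale (δgen g))))
    where
    scale : Carrier × XGen k → Carrier × XGen k
    scale (s , h) = s * a , h

  coeffC-∂-∷ : ∀ {k} u (es : Vec (Edge r) (suc k)) w (b' : Vec (Edge r) k) →
               coeffC (∂ ((u , es) ∷ w)) b' ≈ coeffC (∂ ((u , es) ∷ [])) b' + coeffC (∂ w) b'
  coeffC-∂-∷ {k} u es w b' with normC es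
  ... | nothing = sym (+-identityˡ _)
  ... | just (s , e') = trans (coeffC-++ terms (∂ w) b')
                             (+-congʳ (reflexive (cong (λ l → coeffC l b') (≡.sym (List.++-identityʳ terms)))))
    where
    scale : Carrier × Vec (Edge r) k → Carrier × Vec (Edge r) k
    scale (t , h) = t * (s * u) , h
    terms = List.map scale (∂basis e')

  φ-chain : ∀ {k} (z : XElem (suc k)) → φ (δ z) ≈C ∂ (φ z)
  φ-chain [] b' = refl
  φ-chain ((a , g@((es , vs) , _)) ∷ z) b' = begin
    coeffC (φ (δ ((a , g) ∷ z))) b'                          ≡⟨ cong (λ w → coeffC (φ w) b') (δ-∷ a g z) ⟩
    coeffC (φ (δ ((a , g) ∷ []) ++ δ z)) b'                  ≡⟨ cong (λ w → coeffC w b') (List.map-++ _ (δ ((a , g) ∷ [])) (δ z)) ⟩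
    coeffC (φ (δ ((a , g) ∷ [])) ++ φ (δ z)) b'              ≈⟨ coeffC-++ (φ (δ ((a , g) ∷ []))) (φ (δ z)) b' ⟩
    coeffC (φ (δ ((a , g) ∷ []))) b' + coeffC (φ (δ z)) b'   ≈⟨ +-cong (φ-chain-generator b' a g) (φ-chain z b') ⟩
    coeffC (∂ (φ ((a , g) ∷ []))) b' + coeffC (∂ (φ z)) b'   ≈⟨ coeffC-∂-∷ (sgn (inv (flat es ++ vs)) * a) es (φ z) b' ⟨
    coeffC (∂ (φ ((a , g) ∷ z))) b'                          ∎

theorem5p1 : ∀ {c ℓ : Level} (R : CommutativeRing c ℓ) (r : ℕ) (lam : Fin r → ℕ) →
    (∀ a → 1 ≤ lam a) →
    let open Complexes R r lam in
    ∀ (k : ℕ) →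
      (∀ (z w : XElem k) → z ≈X w → φ z ≈C φ w)
      × (∀ (z : XElem (suc k)) → φ (δ z) ≈C ∂ (φ z))
      × (∀ (z w : XElem k) → φ z ≈C φ w → z ≈X w)
      × (∀ (u : CElem k) → Σ (XElem k) (λ z → φ z ≈C u))
theorem5p1 R r lam lam≥1 k = φ-wellDefined , φ-chain , φ-injective , φ-surjective lam≥1
  where open Isomorphism R r lam
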